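{- Let $\mathcal{P}$ be a poset on $[n]$, let $H$ be a subgroup of $\mathrm{Aut}(\mathcal{P})$, and let $\chi$ be a nontrivial additive character of $\mathbb{F}_q$. For $\overline{I}\in\mathcal{I}(\mathcal{P})/E_H$ and $\overline{J^c}\in\mathcal{I}(\mathcal{P}^*)/E_H^*$, define - $P_{\overline{J^c},\overline{I}}=\sum_{v\in S_{\overline{J^c},E_H^*}}\chi(u\cdot v)$ for any $u\in S_{\overline{I},E_H}$, and - $Q_{\overline{I},\overline{J^c}}=\sum_{u\in S_{\overline{I},E_H}}\chi(u\cdot v)$ for any $v\in S_{\overline{J^c},E_H^*}$. These values do not depend on the choice of $u$, respectively $v$. Then $$\frac{|\{\sigma\in H:\sigma(J^c)=J^c\}|}{(q-1)^{|M(J^c)|}q^{|(J^c)_M|}}\,P_{\overline{J^c},\overline{I}}=\frac{|\{\sigma\in H:\sigma(I)=I\}|}{(q-1)^{|M(I)|}q^{|I_M|}}\,Q_{\overline{I},\overline{J^c}}.$$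
   Context: Poset conventions: - $\mathcal{P}$ is a partial order on $[n]$, and $\mathcal{I}(\mathcal{P})$ is its set of order ideals (down-closed subsets). - $\mathcal{P}^*$ is the dual poset. For $I\in\mathcal{I}(\mathcal{P})$, $I^c=[n]\setminus I\in\mathcal{I}(\mathcal{P}^*)$. - $\mathrm{Aut}(\mathcal{P})$ is the group of order automorphisms of $\mathcal{P}$; it equals $\mathrm{Aut}(\mathcal{P}^*)$. - For $I\in\mathcal{I}(\mathcal{P})$, $M(I)$ is the set of maximal elements of $I$ in $\mathcal{P}$ and $I_M=I\setminus M(I)$. - For $K\in\mathcal{I}(\mathcal{P}^*)$, $M(K)$ is the set of maximal elements of $K$ with respect to $\mathcal{P}^*$ and $K_M=K\setminus M(K)$. - $\langle X\rangle_{\mathcal{P}}$, $\langle X\rangle_{\mathcal{P}^*}$ denote the smallest order ideal containing $X$ in $\mathcal{P}$, $\mathcal{P}^*$. Vectors: $\mathrm{supp}(x)=\{i:x_i\ne0\}$, and $u\cdot v$ is the standard dot product on $\mathbb{F}_q^n$. The relations and spheres: - $E_H$ on $\mathcal{I}(\mathcal{P})$: $(I,J)\in E_H$ iff $\sigma(I)=J$ for some $\sigma\in H$. - $E_H^*$ on $\mathcal{I}(\mathcal{P}^*)$: $(K,L)\in E_H^*$ iff $\sigma(K)=L$ for some $\sigma\in H$. - $\overline{I}$, $\overline{J^c}$ denote the respective classes. - $S_{\overline{I},E_H}=\{y\in\mathbb{F}_q^n:(\langle\mathrm{supp}(y)\rangle_{\mathcal{P}},I)\in E_H\}$ and $S_{\overline{J^c},E_H^*}=\{y:(\langle\mathrm{supp}(y)\rangle_{\mathcal{P}^*},J^c)\in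 E_H^*\}$. In the claim, $q$ in the denominators is the field size. -}

module Defs where

open import Data.Nat as ℕ using (ℕ; zero; suc)
open import Level using (0ℓ)
open import Data.Bool using (Bool; true; false; _∧_; not)
import Data.Bool as Bool
import Data.Bool.ListAction as BoolL
open import Data.Fin using (Fin)
import Data.Fin as Fin
open import Data.Fin.Subset using (Subset; ∣_∣)
open import Data.Vec as Vec using (Vec; []; _∷_; lookup; tabulate)
import Data.Vec.Properties as VecP
open import Data.List as List using (List; []; _∷_; allFin; filter; length; concatMap)
open import Data.List.Membership.Propositional using (_∈_)
open import Data.List.Relation.Unary.Any using (Any; any?)
open import Data.List.Relation.Unary.All using (All)
open import Data.List.Relation.Unary.Unique.Propositional using (Unique)
open import Data.Product using (Σ; ∃; _×_; _,_)
open import Function using (flip; _∘_)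
open import Relation.Nullary using (¬_; Dec; yes; no; ⌊_⌋)
open import Relation.Binary using (Rel; Decidable; IsDecPartialOrder; DecidableEquality)
open import Relation.Binary.PropositionalEquality using (_≡_; _≢_)
open import Algebra.Structures using (IsCommutativeRing)
open import Function.Bundles using (_⇔_)
open import Function.Definitions using (Injective)

record FiniteField : Set₁ where
  infixl 7 _*_
  infixl 6 _+_
  field
    Carrier : Set
    _+_ _*_ : Carrier → Carrier → Carrier
    -_      : Carrier → Carrier
    0# 1#   : Carrier
    isCommutativeRing : IsCommutativeRing _≡_ _+_ _*_ -_ 0# 1#
    0≢1     : 0# ≢ 1#
    inverse : ∀ x → x ≢ 0# → ∃ λ y → x * y ≡ 1#
    _≟_     : DecidableEquality Carrier
    elements : List Carrier
    elements-unique   : Unique elements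
    elements-complete : ∀ x → x ∈ elements

  q : ℕ
  q = length elements

-- The codomain of the character: a field of characteristic zero
-- (stand-in for ℂ).

natTo : {A : Set} → A → A → (A → A → A) → ℕ → A
natTo z o p zero    = z
natTo z o p (suc m) = p o (natTo z o p m)

record CharZeroField : Set₁ where
  infixl 7 _*_
  infixl 6 _+_
  infix 4 _≈_
  field
    Carrier : Set
    _≈_     : Carrier → Carrier → Set
    _+_ _*_ : Carrier → Carrier → Carrier
    -_      : Carrier → Carrier
    0# 1#   : Carrier
    isCommutativeRing : IsCommutativeRing _≈_ _+_ _*_ -_ 0# 1#
    inverse  : ∀ x → ¬ (x ≈ 0#) → ∃ λ y → x * y ≈ 1#
    charZero : ∀ m → ¬ (natTo 0# 1# _+_ (suc m) ≈ 0#)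

  ι : ℕ → Carrier
  ι = natTo 0# 1# _+_

  Σ[_]_ : {A : Set} → List A → (A → Carrier) → Carrier
  Σ[ xs ] f = List.foldr (λ x acc → f x + acc) 0# xs

record NontrivialAdditiveCharacter (F : FiniteField) (R : CharZeroField)
         (χ : FiniteField.Carrier F → CharZeroField.Carrier R) : Set where
  private
    module F = FiniteField F
    module R = CharZeroField R
  field
    homomorphism : ∀ a b → χ (a F.+ b) R.≈ χ a R.* χ b
    nontrivial   : ∃ λ a → ¬ (χ a R.≈ R.1#)

record FinPoset (n : ℕ) : Set₁ where
  field
    _≤_ : Rel (Fin n) 0ℓ
    isDecPartialOrder : IsDecPartialOrder _≡_ _≤_
  open IsDecPartialOrder isDecPartialOrder public using (_≤?_)

anyFin : ∀ {n} → (Fin n → Bool) → Bool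
anyFin {n} p = BoolL.any p (allFin n)

_ᶜ : ∀ {n} → Subset n → Subset n
X ᶜ = Vec.map not X

-- Order-theoretic notions for a decidable relation _≤_ on Fin n.
-- Instantiated with P.≤ for 𝒫 and with flip P.≤ for the dual 𝒫*.
module OrderNotions {n : ℕ} (_≤_ : Rel (Fin n) 0ℓ) (_≤?_ : Decidable _≤_) where

  IsIdeal : Subset n → Set
  IsIdeal I = ∀ i j → j ≤ i → lookup I i ≡ true → lookup I j ≡ true

  ⟨_⟩ : Subset n → Subset n
  ⟨ X ⟩ = tabulate λ i → anyFin λ j → lookup X j ∧ ⌊ i ≤? j ⌋

  M : Subset n → Subset n
  M I = tabulate λ i → lookup I i ∧
          not (anyFin λ j → lookup I j ∧ ⌊ i ≤? j ⌋ ∧ not ⌊ i Fin.≟ j ⌋)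

  _ₘ : Subset n → Subset n
  I ₘ = tabulate λ i → lookup I i ∧ not (lookup (M I) i)

-- Permutations of [n] as lookup tables σ : Vec (Fin n) n, i ↦ lookup σ i

Perm : ℕ → Set
Perm n = Vec (Fin n) n

idPerm : ∀ {n} → Perm n
idPerm = tabulate λ i → i

_∘ₚ_ : ∀ {n} → Perm n → Perm n → Perm n
σ ∘ₚ τ = tabulate λ i → lookup σ (lookup τ i)

image : ∀ {n} → Perm n → Subset n → Subset n
image σ X = tabulate λ j → anyFin λ i → lookup X i ∧ ⌊ lookup σ i Fin.≟ j ⌋

_≟ₛ_ : ∀ {n} → DecidableEquality (Subset n)
_≟ₛ_ = VecP.≡-dec Bool._≟_

module _ {n : ℕ} (P : FinPoset n) where
  open FinPoset P

  IsAut : Perm n → Set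
  IsAut σ = Injective _≡_ _≡_ (lookup σ) × (∀ i j → (i ≤ j) ⇔ (lookup σ i ≤ lookup σ j))

  record IsSubgroupOfAut (H : List (Perm n)) : Set where
    field
      unique    : Unique H
      automorph : All IsAut H
      has-id    : idPerm ∈ H
      closed-∘  : ∀ {σ τ} → σ ∈ H → τ ∈ H → (σ ∘ₚ τ) ∈ H
      closed-⁻¹ : ∀ {σ} → σ ∈ H → ∃ λ τ → τ ∈ H × (σ ∘ₚ τ) ≡ idPerm

-- The relation E_H (resp. E_H^*, same definition on ideals of 𝒫*)
E : ∀ {n} → List (Perm n) → Subset n → Subset n → Set
E H A B = Any (λ σ → image σ A ≡ B) H

E? : ∀ {n} (H : List (Perm n)) → ∀ A B → Dec (E H A B)
E? H A B = any? (λ σ → image σ A ≟ₛ B) H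

stabSize : ∀ {n} → List (Perm n) → Subset n → ℕ
stabSize H I = length (filter (λ σ → image σ I ≟ₛ I) H)

module VectorsOver (F : FiniteField) where
  open FiniteField F

  allVecs : (n : ℕ) → List (Vec Carrier n)
  allVecs zero    = [] ∷ []
  allVecs (suc n) = concatMap (λ a → List.map (a ∷_) (allVecs n)) elements

  supp : ∀ {n} → Vec Carrier n → Subset n
  supp x = Vec.map (λ a → not ⌊ a ≟ 0# ⌋) x

  _·_ : ∀ {n} → Vec Carrier n → Vec Carrier n → Carrier
  u · v = Vec.foldr _ _+_ 0# (Vec.zipWith _*_ u v)

  module Spheres {n : ℕ} (P : FinPoset n) (H : List (Perm n)) where
    open FinPoset P
    module 𝒫  = OrderNotions _≤_ _≤?_
    module 𝒫* = OrderNotions (flip _≤_) (flip _≤?_)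

    InS : Subset n → Vec Carrier n → Set
    InS I y = E H 𝒫.⟨ supp y ⟩ I

    InS* : Subset n → Vec Carrier n → Set
    InS* K y = E H 𝒫*.⟨ supp y ⟩ K

    S : Subset n → List (Vec Carrier n)
    S I = filter (λ y → E? H 𝒫.⟨ supp y ⟩ I) (allVecs n)

    S* : Subset n → List (Vec Carrier n)
    S* K = filter (λ y → E? H 𝒫*.⟨ supp y ⟩ K) (allVecs n)

module Submission where

-- (1) P is well defined: Σ_{w ∈ S*_L} χ(u·w) only depends on the class of ⟨supp u⟩.  It is
--     invariant under H acting by permutation of coordinates; split by the dual ideal
--     K = ⟨supp w⟩*, each piece factors into one-coordinate character sums which, by
--     orthogonality of χ, only see whether u_i = 0, and these zero patterns agree (or the
--     product vanishes for both) when ⟨supp u⟩ = ⟨supp u′⟩.  Dually Q is well defined.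
-- (2) Double counting the table χ(u·w), u ∈ S_Ī, w ∈ S*_{J̄ᶜ}, gives |S_Ī| P = |S*_{J̄ᶜ}| Q.
-- (3) w generates the ideal I iff w is nonzero on M(I), arbitrary on I_M and zero off I,
--     so N(I) = (q-1)^|M(I)| q^|I_M|; with orbit–stabilizer |Stab(I)| |S_Ī| = |H| N(I).
-- (4) Combining (2) with (3) for 𝒫 and 𝒫* and cancelling |H| ≠ 0 (characteristic zero).

open import Defs
open import Data.Nat using (ℕ; _∸_; _^_)
import Data.Nat as ℕ
open import Data.Fin.Subset using (Subset; ∣_∣)
open import Data.Vec using (Vec)
open import Data.List using (List)

open import Data.Nat using (zero; suc; NonZero)
open import Data.Bool using (Bool; true; false; _∧_; not; if_then_else_)
open import Data.Bool.Properties using (⇔→≡; T-≡; not-injective)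
open import Data.Fin using (Fin)
import Data.Fin as Fin
open import Data.Vec using ([]; _∷_; lookup; tabulate)
import Data.Vec.Properties as Vecₚ
open import Data.List using ([]; _∷_; filter; length; concatMap; map; _++_; foldr; allFin; cartesianProductWith)
open import Data.List.Properties using (foldr-map)
open import Data.List.Membership.Propositional using (_∈_; lose; find)
import Data.List.Membership.Propositional.Properties as ∈ₚ
open import Data.List.Relation.Unary.Any using (here; there; satisfied; any?)
open import Data.List.Relation.Unary.Any.Properties using (any⁺; any⁻)
open import Data.List.Relation.Unary.All as All using (All)
open import Data.List.Relation.Unary.AllPairs as AllPairs using ()
open import Data.List.Relation.Unary.Unique.Propositional using (Unique)
import Data.List.Relation.Unary.Unique.Propositional.Properties as Uniqueₚ
open import Data.List.Relation.Binary.Permutation.Propositional using (_↭_; ↭⇒↭ₛ′)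
open import Data.List.Relation.Binary.Permutation.Propositional.Properties as ↭ₚ using ()
import Data.List.Relation.Binary.Permutation.Setoid.Properties as ↭ₛₚ
open import Data.List.Membership.Propositional.Properties.WithK using (unique∧set⇒bag)
open import Data.List.Relation.Binary.BagAndSetEquality using (∼bag⇒↭)
open import Data.Product using (∃; _×_; _,_; proj₁; proj₂)
import Data.Product as Product
open import Data.Empty using (⊥-elim)
open import Function using (_∘_; flip)
import Data.Fin.Properties as Finₚ
import Data.Bool as Bool
open import Data.Fin.Induction using (po-noetherian)
open import Induction.WellFounded using (Acc; acc)
import Relation.Binary.Construct.NonStrictToStrict as ToStrict
import Relation.Binary.Construct.Flip.EqAndOrd as Flip
open import Relation.Binary using (IsDecPartialOrder)
open import Relation.Nullary.Decidable using (_×-dec_; ¬?; decidable-stable)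
open import Function.Bundles using (_⇔_; mk⇔; Equivalence)
open import Relation.Nullary using (¬_; Dec; yes; no; ⌊_⌋)
import Relation.Unary as U
open import Relation.Binary.PropositionalEquality as ≡ using (_≡_; _≢_)
open import Algebra.Bundles using (CommutativeRing)
import Algebra.Properties.CommutativeMonoid.Sum as MonoidSum
import Algebra.Properties.Group
open import Data.Fin.Permutation using (permutation)

_∈ₛ_ : ∀ {n} → Fin n → Subset n → Set
i ∈ₛ X = lookup X i ≡ true

vec-ext : ∀ {A : Set} {n} {xs ys : Vec A n} → (∀ i → lookup xs i ≡ lookup ys i) → xs ≡ ys
vec-ext {xs = xs} {ys} h =
  ≡.trans (≡.sym (Vecₚ.tabulate∘lookup xs)) (≡.trans (Vecₚ.tabulate-cong h) (Vecₚ.tabulate∘lookup ys))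

subset-ext : ∀ {n} {X Y : Subset n} → (∀ i → i ∈ₛ X → i ∈ₛ Y) → (∀ i → i ∈ₛ Y → i ∈ₛ X) → X ≡ Y
subset-ext X⊆Y Y⊆X = vec-ext λ i → ⇔→≡ (mk⇔ (X⊆Y i) (Y⊆X i))

∧-elim : ∀ {a b} → a ∧ b ≡ true → a ≡ true × b ≡ true
∧-elim {true} {true} _ = ≡.refl , ≡.refl

∧-intro : ∀ {a b} → a ≡ true → b ≡ true → a ∧ b ≡ true
∧-intro ≡.refl ≡.refl = ≡.refl

not-true : ∀ {a} → not a ≡ true → a ≡ false
not-true {false} _ = ≡.refl

not-false : ∀ {a} → a ≡ false → not a ≡ true
not-false ≡.refl = ≡.refl

not-true-false : ∀ {a} → ¬ (a ≡ true) → a ≡ false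
not-true-false {false} _ = ≡.refl
not-true-false {true} ¬t = ⊥-elim (¬t ≡.refl)

true≢false : true ≢ false
true≢false ()

⌊⌋-sound : ∀ {A : Set} (a? : Dec A) → ⌊ a? ⌋ ≡ true → A
⌊⌋-sound (yes a) _ = a

⌊⌋-complete : ∀ {A : Set} (a? : Dec A) → A → ⌊ a? ⌋ ≡ true
⌊⌋-complete (yes _) _ = ≡.refl
⌊⌋-complete (no ¬a) a = ⊥-elim (¬a a)

⌊⌋-refute : ∀ {A : Set} (a? : Dec A) → ¬ A → ⌊ a? ⌋ ≡ false
⌊⌋-refute (yes a) ¬a = ⊥-elim (¬a a)
⌊⌋-refute (no _) _ = ≡.refl

⌊⌋-⇔ : ∀ {A B : Set} (a? : Dec A) (b? : Dec B) → A ⇔ B → ⌊ a? ⌋ ≡ ⌊ b? ⌋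
⌊⌋-⇔ a? b? A⇔B = ⇔→≡ (mk⇔ (⌊⌋-complete b? ∘ Equivalence.to A⇔B ∘ ⌊⌋-sound a?)
                           (⌊⌋-complete a? ∘ Equivalence.from A⇔B ∘ ⌊⌋-sound b?))

anyFin-sound : ∀ {n} (p : Fin n → Bool) → anyFin p ≡ true → ∃ λ j → p j ≡ true
anyFin-sound {n} p e =
  Product.map₂ (Equivalence.to T-≡) (satisfied (any⁻ p (allFin n) (Equivalence.from T-≡ e)))

anyFin-complete : ∀ {n} (p : Fin n → Bool) j → p j ≡ true → anyFin p ≡ true
anyFin-complete p j e = Equivalence.to T-≡ (any⁺ p (lose (∈ₚ.∈-allFin j) (Equivalence.from T-≡ e)))

vecsOf : {A : Set} → List A → (n : ℕ) → List (Vec A n)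
vecsOf xs zero = [] ∷ []
vecsOf xs (suc n) = concatMap (λ a → map (a ∷_) (vecsOf xs n)) xs

allVecs≡vecsOf : ∀ (F : FiniteField) n → VectorsOver.allVecs F n ≡ vecsOf (FiniteField.elements F) n
allVecs≡vecsOf F zero = ≡.refl
allVecs≡vecsOf F (suc n) =
  ≡.cong (λ vs → concatMap (λ a → map (a ∷_) vs) (FiniteField.elements F)) (allVecs≡vecsOf F n)

module _ {A : Set} where
  private
    concatMap≡product : ∀ {n} (xs : List A) (ys : List (Vec A n)) →
      concatMap (λ a → map (a ∷_) ys) xs ≡ cartesianProductWith _∷_ xs ys
    concatMap≡product [] ys = ≡.refl
    concatMap≡product (x ∷ xs) ys = ≡.cong (map (x ∷_) ys ++_) (concatMap≡product xs ys)

  vecsOf-unique : ∀ (xs : List A) → Unique xs → ∀ n → Unique (vecsOf xs n)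
  vecsOf-unique xs xs! zero = All.[] AllPairs.∷ AllPairs.[]
  vecsOf-unique xs xs! (suc n) = ≡.subst Unique (≡.sym (concatMap≡product xs (vecsOf xs n)))
    (Uniqueₚ.cartesianProductWith⁺ _∷_ (λ { ≡.refl → ≡.refl , ≡.refl }) xs! (vecsOf-unique xs xs! n))

  vecsOf-complete : ∀ (xs : List A) → (∀ x → x ∈ xs) → ∀ {n} (v : Vec A n) → v ∈ vecsOf xs n
  vecsOf-complete xs all [] = here ≡.refl
  vecsOf-complete xs all {suc n} (x ∷ v) = ≡.subst ((x ∷ v) ∈_) (≡.sym (concatMap≡product xs (vecsOf xs n)))
    (∈ₚ.∈-cartesianProductWith⁺ _∷_ (all x) (vecsOf-complete xs all v))

allSubsets : ∀ n → List (Subset n)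
allSubsets = vecsOf (true ∷ false ∷ [])

allSubsets-unique : ∀ n → Unique (allSubsets n)
allSubsets-unique = vecsOf-unique _ (((λ ()) All.∷ All.[]) AllPairs.∷ (All.[] AllPairs.∷ AllPairs.[]))

allSubsets-complete : ∀ {n} (K : Subset n) → K ∈ allSubsets n
allSubsets-complete = vecsOf-complete _ λ { true → here ≡.refl ; false → there (here ≡.refl) }

module Sums (R : CharZeroField) where
  open CharZeroField R public
  commutativeRing : CommutativeRing _ _
  commutativeRing = record { isCommutativeRing = isCommutativeRing }
  open CommutativeRing commutativeRing public
    using (setoid; refl; sym; trans; reflexive; isEquivalence; +-cong; *-cong; +-congˡ; +-congʳ;
           *-congˡ; *-congʳ; +-comm; *-comm; +-assoc; *-assoc; +-identityˡ; +-identityʳ;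
           *-identityˡ; *-identityʳ; zeroˡ; zeroʳ; distribˡ; distribʳ; -‿inverseˡ; -‿inverseʳ;
           -‿cong; _-_; ring; +-isCommutativeMonoid; *-commutativeMonoid; commutativeSemiring)
  open import Algebra.Solver.Ring.NaturalCoefficients.Default commutativeSemiring
  open import Relation.Binary.Reasoning.Setoid setoid public
  open import Algebra.Properties.Group (CommutativeRing.+-group commutativeRing) public
    using (inverseʳ-unique; x∙y⁻¹≈ε⇒x≈y) renaming (∙-cancelˡ to +-cancelˡ)

  private variable A B : Set

  [_]ᵇ : Bool → Carrier
  [ true ]ᵇ = 1#
  [ false ]ᵇ = 0#

  Σ-cong : ∀ (xs : List A) {f g : A → Carrier} → (∀ x → f x ≈ g x) → Σ[ xs ] f ≈ Σ[ xs ] g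
  Σ-cong [] _ = refl
  Σ-cong (x ∷ xs) f≈g = +-cong (f≈g x) (Σ-cong xs f≈g)

  Σ-cong∈ : ∀ (xs : List A) {f g : A → Carrier} → (∀ x → x ∈ xs → f x ≈ g x) → Σ[ xs ] f ≈ Σ[ xs ] g
  Σ-cong∈ [] _ = refl
  Σ-cong∈ (x ∷ xs) f≈g = +-cong (f≈g x (here ≡.refl)) (Σ-cong∈ xs (λ y y∈ → f≈g y (there y∈)))

  Σ-zero : ∀ (xs : List A) → Σ[ xs ] (λ _ → 0#) ≈ 0#
  Σ-zero [] = refl
  Σ-zero (_ ∷ xs) = trans (+-identityˡ _) (Σ-zero xs)

  Σ-+ : ∀ (xs : List A) (f g : A → Carrier) → Σ[ xs ] (λ x → f x + g x) ≈ Σ[ xs ] f + Σ[ xs ] g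
  Σ-+ [] _ _ = sym (+-identityˡ 0#)
  Σ-+ (x ∷ xs) f g = trans (+-congˡ (Σ-+ xs f g))
    (solve 4 (λ a b c d → (a :+ b) :+ (c :+ d) := (a :+ c) :+ (b :+ d)) refl (f x) (g x) (Σ[ xs ] f) (Σ[ xs ] g))

  Σ-*ˡ : ∀ (xs : List A) (c : Carrier) (f : A → Carrier) → c * Σ[ xs ] f ≈ Σ[ xs ] (λ x → c * f x)
  Σ-*ˡ [] c _ = zeroʳ c
  Σ-*ˡ (x ∷ xs) c f = trans (distribˡ c (f x) _) (+-congˡ (Σ-*ˡ xs c f))

  Σ-*ʳ : ∀ (xs : List A) (c : Carrier) (f : A → Carrier) → Σ[ xs ] f * c ≈ Σ[ xs ] (λ x → f x * c)
  Σ-*ʳ xs c f = trans (*-comm _ c) (trans (Σ-*ˡ xs c f) (Σ-cong xs (λ x → *-comm c (f x))))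

  Σ-swap : ∀ (xs : List A) (ys : List B) (f : A → B → Carrier) →
    Σ[ xs ] (λ x → Σ[ ys ] (f x)) ≈ Σ[ ys ] (λ y → Σ[ xs ] (λ x → f x y))
  Σ-swap [] ys _ = sym (Σ-zero ys)
  Σ-swap (x ∷ xs) ys f = trans (+-congˡ (Σ-swap xs ys f)) (sym (Σ-+ ys (f x) _))

  Σ-++ : ∀ (xs ys : List A) (f : A → Carrier) → Σ[ xs ++ ys ] f ≈ Σ[ xs ] f + Σ[ ys ] f
  Σ-++ [] _ _ = sym (+-identityˡ _)
  Σ-++ (x ∷ xs) ys f = trans (+-congˡ (Σ-++ xs ys f)) (sym (+-assoc _ _ _))

  Σ-map : ∀ (xs : List A) (g : A → B) (f : B → Carrier) → Σ[ map g xs ] f ≈ Σ[ xs ] (f ∘ g)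
  Σ-map [] _ _ = refl
  Σ-map (x ∷ xs) g f = +-congˡ (Σ-map xs g f)

  Σ-concatMap : ∀ (xs : List A) (g : A → List B) (f : B → Carrier) →
    Σ[ concatMap g xs ] f ≈ Σ[ xs ] (λ x → Σ[ g x ] f)
  Σ-concatMap [] _ _ = refl
  Σ-concatMap (x ∷ xs) g f = trans (Σ-++ (g x) (concatMap g xs) f) (+-congˡ (Σ-concatMap xs g f))

  ι-+ : ∀ m n → ι (m ℕ.+ n) ≈ ι m + ι n
  ι-+ zero _ = sym (+-identityˡ _)
  ι-+ (suc m) n = trans (+-congˡ (ι-+ m n)) (sym (+-assoc _ _ _))

  ι-* : ∀ m n → ι (m ℕ.* n) ≈ ι m * ι n
  ι-* zero _ = sym (zeroˡ _)
  ι-* (suc m) n = trans (ι-+ n (m ℕ.* n))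
    (trans (+-cong (sym (*-identityˡ _)) (ι-* m n)) (sym (distribʳ _ _ _)))

  ι-1 : ι 1 ≈ 1#
  ι-1 = +-identityʳ 1#

  Σ-const : ∀ (xs : List A) (c : Carrier) → Σ[ xs ] (λ _ → c) ≈ ι (length xs) * c
  Σ-const [] c = sym (zeroˡ c)
  Σ-const (_ ∷ xs) c = trans (+-cong (sym (*-identityˡ c)) (Σ-const xs c)) (sym (distribʳ c 1# _))

  Σ-filter : ∀ {p : A → Set} (p? : U.Decidable p) (xs : List A) (f : A → Carrier) →
    Σ[ filter p? xs ] f ≈ Σ[ xs ] (λ x → [ ⌊ p? x ⌋ ]ᵇ * f x)
  Σ-filter p? [] _ = refl
  Σ-filter p? (x ∷ xs) f with p? x
  ... | yes _ = +-cong (sym (*-identityˡ _)) (Σ-filter p? xs f)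
  ... | no _ = trans (Σ-filter p? xs f) (sym (trans (+-congʳ (zeroˡ _)) (+-identityˡ _)))

  ι-count : ∀ {p : A → Set} (p? : U.Decidable p) (xs : List A) →
    ι (length (filter p? xs)) ≈ Σ[ xs ] (λ x → [ ⌊ p? x ⌋ ]ᵇ * 1#)
  ι-count p? xs = trans (sym (*-identityʳ _)) (trans (sym (Σ-const (filter p? xs) 1#)) (Σ-filter p? xs (λ _ → 1#)))

  Σ-↭ : ∀ {xs ys : List A} (f : A → Carrier) → xs ↭ ys → Σ[ xs ] f ≈ Σ[ ys ] f
  Σ-↭ {xs = xs} {ys} f xs↭ys = begin
    Σ[ xs ] f                ≡⟨ foldr-map _+_ f 0# xs ⟨
    foldr _+_ 0# (map f xs)  ≈⟨ ↭ₛₚ.foldr-commMonoid setoid +-isCommutativeMonoid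
                                  (↭⇒↭ₛ′ isEquivalence (↭ₚ.map⁺ f xs↭ys)) ⟩
    foldr _+_ 0# (map f ys)  ≡⟨ foldr-map _+_ f 0# ys ⟩
    Σ[ ys ] f                ∎

  Σ-reindex : ∀ (xs : List A) (π : A → A) (f : A → Carrier) → Unique xs →
    (∀ {x y} → π x ≡ π y → x ≡ y) → (∀ x → x ∈ xs → π x ∈ xs) →
    (∀ y → y ∈ xs → ∃ λ x → x ∈ xs × π x ≡ y) →
    Σ[ xs ] (f ∘ π) ≈ Σ[ xs ] f
  Σ-reindex xs π f xs! π-inj π-into π-onto =
    trans (sym (Σ-map xs π f)) (Σ-↭ f (∼bag⇒↭ (unique∧set⇒bag (Uniqueₚ.map⁺ π-inj xs!) xs! (mk⇔ into onto))))
    where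
    into : ∀ {y} → y ∈ map π xs → y ∈ xs
    into y∈ = let (x , x∈ , y≡πx) = ∈ₚ.∈-map⁻ π y∈ in ≡.subst (_∈ xs) (≡.sym y≡πx) (π-into x x∈)
    onto : ∀ {y} → y ∈ xs → y ∈ map π xs
    onto y∈ = let (x , x∈ , πx≡y) = π-onto _ y∈ in ≡.subst (_∈ map π xs) πx≡y (∈ₚ.∈-map⁺ π x∈)

  Σ-δ : ∀ (xs : List A) (e : A → Bool) (x : A) (f : A → Carrier) → Unique xs → x ∈ xs →
    (∀ y → e y ≡ true → y ≡ x) → e x ≡ true → Σ[ xs ] (λ y → [ e y ]ᵇ * f y) ≈ f x
  Σ-δ (y ∷ xs) e x f (y∉xs AllPairs.∷ xs!) (here ≡.refl) only ex =
    trans (+-cong (trans (*-congʳ (reflexive (≡.cong [_]ᵇ ex))) (*-identityˡ _))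
                  (trans (Σ-cong∈ xs vanish) (Σ-zero xs))) (+-identityʳ _)
    where
    vanish : ∀ z → z ∈ xs → [ e z ]ᵇ * f z ≈ 0#
    vanish z z∈ with e z in ez
    ... | false = zeroˡ _
    ... | true = ⊥-elim (All.lookup y∉xs z∈ (≡.sym (only z ez)))
  Σ-δ (y ∷ xs) e x f (y∉xs AllPairs.∷ xs!) (there x∈) only ex with e y in ey
  ... | true = ⊥-elim (All.lookup y∉xs x∈ (only y ey))
  ... | false = trans (+-cong (zeroˡ _) (Σ-δ xs e x f xs! x∈ only ex)) (+-identityˡ _)

  cancel-by-inverse : ∀ {x y} → x * y ≈ 1# → ∀ c → y * (x * c) ≈ c
  cancel-by-inverse {x} {y} xy≈1 c = trans (sym (*-assoc y x c)) (trans (*-congʳ (trans (*-comm y x) xy≈1)) (*-identityˡ c))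

  -- characteristic zero: nonzero naturals are invertible, hence cancellable
  ι-cancel : ∀ m .{{_ : NonZero m}} {a b} → ι m * a ≈ ι m * b → a ≈ b
  ι-cancel (suc k) {a} {b} eq = begin
    a                   ≈⟨ cancel-by-inverse ιy≈1 a ⟨
    y * (ι (suc k) * a) ≈⟨ *-congˡ eq ⟩
    y * (ι (suc k) * b) ≈⟨ cancel-by-inverse ιy≈1 b ⟩
    b                   ∎
    where
    y = proj₁ (inverse (ι (suc k)) (charZero k))
    ιy≈1 = proj₂ (inverse (ι (suc k)) (charZero k))

  cross-multiply : ∀ m .{{_ : NonZero m}} {s s′ a b d d′ p p′} →
    s * a ≈ ι m * d → s′ * b ≈ ι m * d′ → a * p ≈ b * p′ → s′ * d * p ≈ s * d′ * p′
  cross-multiply m {s} {s′} {a} {b} {d} {d′} {p} {p′} sa≈md s′b≈md′ ap≈bp′ = ι-cancel m (begin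
    ι m * (s′ * d * p)   ≈⟨ solve 4 (λ h s′ d p → h :* (s′ :* d :* p) := s′ :* (h :* d) :* p) refl (ι m) s′ d p ⟩
    s′ * (ι m * d) * p   ≈⟨ *-congʳ (*-congˡ sa≈md) ⟨
    s′ * (s * a) * p     ≈⟨ solve 4 (λ s′ s a p → s′ :* (s :* a) :* p := s :* s′ :* (a :* p)) refl s′ s a p ⟩
    s * s′ * (a * p)     ≈⟨ *-congˡ ap≈bp′ ⟩
    s * s′ * (b * p′)    ≈⟨ solve 4 (λ s s′ b p′ → s :* s′ :* (b :* p′) := s :* (s′ :* b) :* p′) refl s s′ b p′ ⟩
    s * (s′ * b) * p′    ≈⟨ *-congʳ (*-congˡ s′b≈md′) ⟩
    s * (ι m * d′) * p′  ≈⟨ solve 4 (λ h s d′ p′ → s :* (h :* d′) :* p′ := h :* (s :* d′ :* p′)) refl (ι m) s d′ p′ ⟩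
    ι m * (s * d′ * p′)  ∎)

  double-count : ∀ (xs : List A) (ys : List B) (f : A → B → Carrier) {r c} →
    (∀ x → x ∈ xs → Σ[ ys ] (f x) ≈ r) → (∀ y → y ∈ ys → Σ[ xs ] (λ x → f x y) ≈ c) →
    ι (length xs) * r ≈ ι (length ys) * c
  double-count xs ys f {r} {c} rows columns = begin
    ι (length xs) * r                        ≈⟨ Σ-const xs r ⟨
    Σ[ xs ] (λ _ → r)                        ≈⟨ Σ-cong∈ xs rows ⟨
    Σ[ xs ] (λ x → Σ[ ys ] (f x))            ≈⟨ Σ-swap xs ys f ⟩
    Σ[ ys ] (λ y → Σ[ xs ] (λ x → f x y))    ≈⟨ Σ-cong∈ ys columns ⟩
    Σ[ ys ] (λ _ → c)                        ≈⟨ Σ-const ys c ⟩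
    ι (length ys) * c                        ∎

  module Multiplicative = MonoidSum *-commutativeMonoid

  Π : ∀ {n} → (Fin n → Carrier) → Carrier
  Π = Multiplicative.sum

  Π-cong : ∀ {n} {f g : Fin n → Carrier} → (∀ i → f i ≈ g i) → Π f ≈ Π g
  Π-cong = Multiplicative.sum-cong-≋

  Π-mul : ∀ {n} (f g : Fin n → Carrier) → Π (λ i → f i * g i) ≈ Π f * Π g
  Π-mul = Multiplicative.∑-distrib-+

  Π-reindex : ∀ {n} (π π⁻¹ : Fin n → Fin n) → (∀ i → π (π⁻¹ i) ≡ i) → (∀ i → π⁻¹ (π i) ≡ i) →
    (f : Fin n → Carrier) → Π (f ∘ π) ≈ Π f
  Π-reindex π π⁻¹ πl πr f = sym (Multiplicative.∑-permute f (permutation π π⁻¹ πl πr))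

  Π-zero : ∀ {n} (f : Fin n → Carrier) i → f i ≈ 0# → Π f ≈ 0#
  Π-zero f Fin.zero fi≈0 = trans (*-congʳ fi≈0) (zeroˡ _)
  Π-zero f (Fin.suc i) fi≈0 = trans (*-congˡ (Π-zero (f ∘ Fin.suc) i fi≈0)) (zeroʳ _)

  Π-one : ∀ {n} (f : Fin n → Carrier) → (∀ i → f i ≈ 1#) → Π f ≈ 1#
  Π-one {zero} _ _ = refl
  Π-one {suc n} f f≈1 = trans (*-cong (f≈1 Fin.zero) (Π-one (f ∘ Fin.suc) (f≈1 ∘ Fin.suc))) (*-identityˡ 1#)

  Π-indicator : ∀ {n} {A : Set} (a? : Dec A) (b : Fin n → Bool) → A ⇔ (∀ i → b i ≡ true) →
    [ ⌊ a? ⌋ ]ᵇ ≈ Π (λ i → [ b i ]ᵇ)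
  Π-indicator (yes a) b A⇔all = sym (Π-one _ (λ i → reflexive (≡.cong [_]ᵇ (Equivalence.to A⇔all a i))))
  Π-indicator {n} (no ¬a) b A⇔all =
    let (i , bi≢true) = Finₚ.¬∀⟶∃¬ n _ (λ i → b i Bool.≟ true) (¬a ∘ Equivalence.from A⇔all)
    in sym (Π-zero _ i (reflexive (≡.cong [_]ᵇ (not-true-false bi≢true))))

  Σ-fibres : ∀ {n} (xs : List A) (c : A → Subset n) (p : Subset n → Bool) (g : A → Carrier) →
    Σ[ xs ] (λ x → [ p (c x) ]ᵇ * g x) ≈
    Σ[ allSubsets n ] (λ K → [ p K ]ᵇ * Σ[ xs ] (λ x → [ ⌊ c x ≟ₛ K ⌋ ]ᵇ * g x))
  Σ-fibres {n = n} xs c p g = sym (begin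
    Σ[ allSubsets n ] (λ K → [ p K ]ᵇ * Σ[ xs ] (λ x → [ ⌊ c x ≟ₛ K ⌋ ]ᵇ * g x))
      ≈⟨ Σ-cong (allSubsets n) (λ K → Σ-*ˡ xs _ _) ⟩
    Σ[ allSubsets n ] (λ K → Σ[ xs ] (λ x → [ p K ]ᵇ * ([ ⌊ c x ≟ₛ K ⌋ ]ᵇ * g x)))
      ≈⟨ Σ-swap (allSubsets n) xs _ ⟩
    Σ[ xs ] (λ x → Σ[ allSubsets n ] (λ K → [ p K ]ᵇ * ([ ⌊ c x ≟ₛ K ⌋ ]ᵇ * g x)))
      ≈⟨ Σ-cong xs (λ x → Σ-cong (allSubsets n) (λ K →
           solve 3 (λ a b d → a :* (b :* d) := b :* (a :* d)) refl [ p K ]ᵇ [ ⌊ c x ≟ₛ K ⌋ ]ᵇ (g x))) ⟩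
    Σ[ xs ] (λ x → Σ[ allSubsets n ] (λ K → [ ⌊ c x ≟ₛ K ⌋ ]ᵇ * ([ p K ]ᵇ * g x)))
      ≈⟨ Σ-cong xs (λ x → Σ-δ (allSubsets n) (λ K → ⌊ c x ≟ₛ K ⌋) (c x) (λ K → [ p K ]ᵇ * g x)
           (allSubsets-unique n) (allSubsets-complete (c x)) (λ K e → ≡.sym (⌊⌋-sound (c x ≟ₛ K) e))
           (⌊⌋-complete (c x ≟ₛ c x) ≡.refl)) ⟩
    Σ[ xs ] (λ x → [ p (c x) ]ᵇ * g x) ∎)

  Π-power : ∀ {n} (m : Subset n) (A : ℕ) → Π (λ i → ι (if lookup m i then A else 1)) ≈ ι (A ^ ∣ m ∣)
  Π-power [] A = sym ι-1
  Π-power (true ∷ m) A = trans (*-congˡ (Π-power m A)) (sym (ι-* A (A ^ ∣ m ∣)))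
  Π-power (false ∷ m) A = trans (*-congʳ ι-1) (trans (*-identityˡ _) (Π-power m A))

  Σ-vecsOf-Π : ∀ (xs : List A) n (f : Fin n → A → Carrier) →
    Σ[ vecsOf xs n ] (λ w → Π (λ i → f i (lookup w i))) ≈ Π (λ i → Σ[ xs ] (f i))
  Σ-vecsOf-Π xs zero f = +-identityʳ 1#
  Σ-vecsOf-Π xs (suc n) f = begin
    Σ[ vecsOf xs (suc n) ] G
      ≈⟨ Σ-concatMap xs (λ a → map (a ∷_) (vecsOf xs n)) G ⟩
    Σ[ xs ] (λ a → Σ[ map (a ∷_) (vecsOf xs n) ] G)
      ≈⟨ Σ-cong xs (λ a → Σ-map (vecsOf xs n) (a ∷_) G) ⟩
    Σ[ xs ] (λ a → Σ[ vecsOf xs n ] (λ v → f Fin.zero a * Π (λ i → f (Fin.suc i) (lookup v i))))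
      ≈⟨ Σ-cong xs (λ a → sym (Σ-*ˡ (vecsOf xs n) (f Fin.zero a) _)) ⟩
    Σ[ xs ] (λ a → f Fin.zero a * Σ[ vecsOf xs n ] (λ v → Π (λ i → f (Fin.suc i) (lookup v i))))
      ≈⟨ Σ-cong xs (λ a → *-congˡ (Σ-vecsOf-Π xs n (f ∘ Fin.suc))) ⟩
    Σ[ xs ] (λ a → f Fin.zero a * Π (λ i → Σ[ xs ] (f (Fin.suc i))))
      ≈⟨ Σ-*ʳ xs _ (f Fin.zero) ⟨
    Π (λ i → Σ[ xs ] (f i)) ∎
    where
    G : Vec _ (suc n) → Carrier
    G w = Π (λ i → f i (lookup w i))

dual : ∀ {n} → FinPoset n → FinPoset n
dual P = record
  { _≤_ = flip _≤_
  ; isDecPartialOrder = record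
      { isPartialOrder = Flip.isPartialOrder isPartialOrder
      ; _≟_ = Fin._≟_
      ; _≤?_ = flip _≤?_
      }
  }
  where open FinPoset P
        open IsDecPartialOrder isDecPartialOrder using (isPartialOrder)

module PosetFacts {n : ℕ} (P : FinPoset n) where
  open FinPoset P
  open IsDecPartialOrder isDecPartialOrder using (isPartialOrder)
    renaming (refl to ≤-refl; trans to ≤-trans)
  open OrderNotions _≤_ _≤?_ public

  closure-sound : ∀ X i → i ∈ₛ ⟨ X ⟩ → ∃ λ j → j ∈ₛ X × i ≤ j
  closure-sound X i i∈ =
    let (j , e) = anyFin-sound _ (≡.trans (≡.sym (Vecₚ.lookup∘tabulate _ i)) i∈)
        (j∈X , i≤j) = ∧-elim e
    in j , j∈X , ⌊⌋-sound (i ≤? j) i≤j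

  closure-complete : ∀ X i j → j ∈ₛ X → i ≤ j → i ∈ₛ ⟨ X ⟩
  closure-complete X i j j∈X i≤j =
    ≡.trans (Vecₚ.lookup∘tabulate _ i) (anyFin-complete _ j (∧-intro j∈X (⌊⌋-complete (i ≤? j) i≤j)))

  closure-ideal : ∀ X → IsIdeal ⟨ X ⟩
  closure-ideal X i j j≤i i∈ =
    let (k , k∈X , i≤k) = closure-sound X i i∈ in closure-complete X j k k∈X (≤-trans j≤i i≤k)

  IsMaximalIn : Subset n → Fin n → Set
  IsMaximalIn K i = i ∈ₛ K × (∀ j → j ∈ₛ K → i ≤ j → i ≡ j)

  maximal-sound : ∀ K i → i ∈ₛ M K → IsMaximalIn K i
  maximal-sound K i i∈M =
    let (i∈K , noneAbove) = ∧-elim (≡.trans (≡.sym (Vecₚ.lookup∘tabulate _ i)) i∈M)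
    in i∈K , λ j j∈K i≤j → decidable-stable (i Fin.≟ j) λ i≢j →
         true≢false (≡.trans (≡.sym (anyFin-complete _ j
           (∧-intro j∈K (∧-intro (⌊⌋-complete (i ≤? j) i≤j) (not-false (⌊⌋-refute (i Fin.≟ j) i≢j))))))
           (not-true noneAbove))

  maximal-complete : ∀ K i → IsMaximalIn K i → i ∈ₛ M K
  maximal-complete K i (i∈K , noneAbove) =
    ≡.trans (Vecₚ.lookup∘tabulate _ i) (∧-intro i∈K (not-false (not-true-false strictlyAbove)))
    where
    strictlyAbove : ¬ (anyFin (λ j → lookup K j ∧ ⌊ i ≤? j ⌋ ∧ not ⌊ i Fin.≟ j ⌋) ≡ true)
    strictlyAbove e =
      let (j , ej) = anyFin-sound _ e
          (j∈K , rest) = ∧-elim ej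
          (i≤j , i≢j) = ∧-elim rest
      in true≢false (≡.trans (≡.sym (⌊⌋-complete (i Fin.≟ j) (noneAbove j j∈K (⌊⌋-sound (i ≤? j) i≤j))))
                            (not-true i≢j))

  -- Every element of a subset lies below a maximal element of it
  -- (by Noetherian induction on the strict order of the finite poset).
  below-maximal : ∀ K i → i ∈ₛ K → ∃ λ m → m ∈ₛ M K × i ≤ m
  below-maximal K i = go i (po-noetherian isPartialOrder i)
    where
    _<_ = ToStrict._<_ _≡_ _≤_
    go : ∀ i → Acc (flip _<_) i → i ∈ₛ K → ∃ λ m → m ∈ₛ M K × i ≤ m
    go i (acc above) i∈K with Finₚ.any? (λ j → (lookup K j Bool.≟ true) ×-dec (i ≤? j) ×-dec ¬? (i Fin.≟ j))
    ... | yes (j , j∈K , i≤j , i≢j) =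
      let (m , m∈M , j≤m) = go j (above (i≤j , i≢j)) j∈K in m , m∈M , ≤-trans i≤j j≤m
    ... | no noneAbove = i , maximal-complete K i (i∈K , isMax) , ≤-refl
      where
      isMax : ∀ j → j ∈ₛ K → i ≤ j → i ≡ j
      isMax j j∈K i≤j = decidable-stable (i Fin.≟ j) (λ i≢j → noneAbove (j , j∈K , i≤j , i≢j))

  closure-≡⇒ : ∀ X K → ⟨ X ⟩ ≡ K → (∀ i → i ∈ₛ X → i ∈ₛ K) × (∀ i → i ∈ₛ M K → i ∈ₛ X)
  closure-≡⇒ X K ≡.refl = (λ i i∈X → closure-complete X i i i∈X ≤-refl) , maxInX
    where
    maxInX : ∀ i → i ∈ₛ M ⟨ X ⟩ → i ∈ₛ X
    maxInX i i∈M =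
      let (i∈⟨X⟩ , isMax) = maximal-sound ⟨ X ⟩ i i∈M
          (j , j∈X , i≤j) = closure-sound X i i∈⟨X⟩
      in ≡.subst (_∈ₛ X) (≡.sym (isMax j (closure-complete X j j j∈X ≤-refl) i≤j)) j∈X

  closure-≡⇐ : ∀ X K → IsIdeal K → (∀ i → i ∈ₛ X → i ∈ₛ K) → (∀ i → i ∈ₛ M K → i ∈ₛ X) → ⟨ X ⟩ ≡ K
  closure-≡⇐ X K K-ideal X⊆K MK⊆X = subset-ext
    (λ i i∈ → let (j , j∈X , i≤j) = closure-sound X i i∈ in K-ideal j i i≤j (X⊆K j j∈X))
    (λ i i∈K → let (m , m∈M , i≤m) = below-maximal K i i∈K in closure-complete X i m (MK⊆X m m∈M) i≤m)

  ₘ-lookup : ∀ K i → lookup (K ₘ) i ≡ lookup K i ∧ not (lookup (M K) i)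
  ₘ-lookup K i = Vecₚ.lookup∘tabulate _ i

complement-ideal : ∀ {n} (P : FinPoset n) J → PosetFacts.IsIdeal P J → PosetFacts.IsIdeal (dual P) (J ᶜ)
complement-ideal P J J-ideal i j i≤j i∈Jᶜ = ≡.trans (Vecₚ.lookup-map j not J) (not-false (not-true-false λ j∈J →
  true≢false (≡.trans (≡.sym (J-ideal j i i≤j j∈J)) (not-true (≡.trans (≡.sym (Vecₚ.lookup-map i not J)) i∈Jᶜ)))))

module _ {n : ℕ} where

  lookup-∘ₚ : ∀ (σ τ : Perm n) i → lookup (σ ∘ₚ τ) i ≡ lookup σ (lookup τ i)
  lookup-∘ₚ σ τ i = Vecₚ.lookup∘tabulate _ i

  ∘ₚ-assoc : ∀ (σ τ ρ : Perm n) → (σ ∘ₚ τ) ∘ₚ ρ ≡ σ ∘ₚ (τ ∘ₚ ρ)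
  ∘ₚ-assoc σ τ ρ = vec-ext λ i → begin
    lookup ((σ ∘ₚ τ) ∘ₚ ρ) i          ≡⟨ lookup-∘ₚ (σ ∘ₚ τ) ρ i ⟩
    lookup (σ ∘ₚ τ) (lookup ρ i)      ≡⟨ lookup-∘ₚ σ τ (lookup ρ i) ⟩
    lookup σ (lookup τ (lookup ρ i))  ≡⟨ ≡.cong (lookup σ) (lookup-∘ₚ τ ρ i) ⟨
    lookup σ (lookup (τ ∘ₚ ρ) i)      ≡⟨ lookup-∘ₚ σ (τ ∘ₚ ρ) i ⟨
    lookup (σ ∘ₚ (τ ∘ₚ ρ)) i          ∎
    where open ≡.≡-Reasoning

  ∘ₚ-identityʳ : ∀ (σ : Perm n) → σ ∘ₚ idPerm ≡ σ
  ∘ₚ-identityʳ σ = vec-ext λ i → ≡.trans (lookup-∘ₚ σ idPerm i) (≡.cong (lookup σ) (Vecₚ.lookup∘tabulate _ i))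

  record Inverses (σ τ : Perm n) : Set where
    field
      σ∘τ : ∀ j → lookup σ (lookup τ j) ≡ j
      τ∘σ : ∀ i → lookup τ (lookup σ i) ≡ i

    composite : σ ∘ₚ τ ≡ idPerm
    composite = vec-ext λ j → ≡.trans (lookup-∘ₚ σ τ j) (≡.trans (σ∘τ j) (≡.sym (Vecₚ.lookup∘tabulate _ j)))

  inverses-sym : ∀ {σ τ} → Inverses σ τ → Inverses τ σ
  inverses-sym inv = record { σ∘τ = Inverses.τ∘σ inv ; τ∘σ = Inverses.σ∘τ inv }

  inverses-from : ∀ σ τ → σ ∘ₚ τ ≡ idPerm → (∀ {i j} → lookup σ i ≡ lookup σ j → i ≡ j) → Inverses σ τ
  inverses-from σ τ σ∘τ≡id σ-inj = record { σ∘τ = right ; τ∘σ = λ i → σ-inj (right (lookup σ i)) }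
    where
    right : ∀ j → lookup σ (lookup τ j) ≡ j
    right j = ≡.trans (≡.sym (lookup-∘ₚ σ τ j)) (≡.trans (≡.cong (λ π → lookup π j) σ∘τ≡id) (Vecₚ.lookup∘tabulate _ j))

  image-sound : ∀ (σ : Perm n) X j → j ∈ₛ image σ X → ∃ λ i → i ∈ₛ X × lookup σ i ≡ j
  image-sound σ X j j∈ =
    let (i , e) = anyFin-sound _ (≡.trans (≡.sym (Vecₚ.lookup∘tabulate _ j)) j∈)
        (i∈X , σi≡j) = ∧-elim e
    in i , i∈X , ⌊⌋-sound (lookup σ i Fin.≟ j) σi≡j

  image-complete : ∀ (σ : Perm n) X i → i ∈ₛ X → lookup σ i ∈ₛ image σ X
  image-complete σ X i i∈X =
    ≡.trans (Vecₚ.lookup∘tabulate _ (lookup σ i)) (anyFin-complete _ i (∧-intro i∈X (⌊⌋-complete (_ Fin.≟ _) ≡.refl)))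

  image-∘ₚ : ∀ (σ τ : Perm n) X → image (σ ∘ₚ τ) X ≡ image σ (image τ X)
  image-∘ₚ σ τ X = subset-ext
    (λ j j∈ → let (i , i∈X , στi≡j) = image-sound (σ ∘ₚ τ) X j j∈ in
      ≡.subst (_∈ₛ image σ (image τ X)) (≡.trans (≡.sym (lookup-∘ₚ σ τ i)) στi≡j)
        (image-complete σ (image τ X) (lookup τ i) (image-complete τ X i i∈X)))
    (λ j j∈ → let (k , k∈τX , σk≡j) = image-sound σ (image τ X) j j∈
                  (i , i∈X , τi≡k) = image-sound τ X k k∈τX in
      ≡.subst (_∈ₛ image (σ ∘ₚ τ) X) (≡.trans (lookup-∘ₚ σ τ i) (≡.trans (≡.cong (lookup σ) τi≡k) σk≡j))
        (image-complete (σ ∘ₚ τ) X i i∈X))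

  image-lookup : ∀ {σ τ} → Inverses σ τ → ∀ X j → lookup (image σ X) j ≡ lookup X (lookup τ j)
  image-lookup {σ} {τ} inv X j = ⇔→≡ (mk⇔
    (λ j∈ → let (i , i∈X , σi≡j) = image-sound σ X j j∈ in
       ≡.subst (_∈ₛ X) (≡.trans (≡.sym (τ∘σ i)) (≡.cong (lookup τ) σi≡j)) i∈X)
    (λ τj∈X → ≡.subst (_∈ₛ image σ X) (σ∘τ j) (image-complete σ X (lookup τ j) τj∈X)))
    where open Inverses inv

  image-inverse : ∀ {σ τ} → Inverses σ τ → ∀ X → image τ (image σ X) ≡ X
  image-inverse {σ} {τ} inv X = vec-ext λ j →
    ≡.trans (image-lookup (inverses-sym inv) (image σ X) j)
            (≡.trans (image-lookup inv X (lookup σ j)) (≡.cong (lookup X) (Inverses.τ∘σ inv j)))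

module _ {n : ℕ} (P : FinPoset n) where
  open FinPoset P
  open PosetFacts P

  closure-image : ∀ {σ τ} → Inverses σ τ → (∀ i j → (i ≤ j) ⇔ (lookup σ i ≤ lookup σ j)) →
    ∀ X → ⟨ image σ X ⟩ ≡ image σ ⟨ X ⟩
  closure-image {σ} {τ} inv σ-mono X = subset-ext
    (λ j j∈ → let (k , k∈σX , j≤k) = closure-sound (image σ X) j j∈ in
       relabel ⟨ X ⟩ j (closure-complete X (lookup τ j) (lookup τ k) (≡.trans (≡.sym (image-lookup inv X k)) k∈σX)
         (Equivalence.from (σ-mono _ _) (≡.subst₂ _≤_ (≡.sym (σ∘τ j)) (≡.sym (σ∘τ k)) j≤k))))
    (λ j j∈ → let (i , i∈X , τj≤i) = closure-sound X (lookup τ j) (≡.trans (≡.sym (image-lookup inv ⟨ X ⟩ j)) j∈) in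
       closure-complete (image σ X) j (lookup σ i) (image-complete σ X i i∈X)
         (≡.subst (_≤ lookup σ i) (σ∘τ j) (Equivalence.to (σ-mono _ _) τj≤i)))
    where
    open Inverses inv
    relabel : ∀ Y j → lookup τ j ∈ₛ Y → j ∈ₛ image σ Y
    relabel Y j τj∈Y = ≡.trans (image-lookup inv Y j) τj∈Y

dual-subgroup : ∀ {n} {P : FinPoset n} {H} → IsSubgroupOfAut P H → IsSubgroupOfAut (dual P) H
dual-subgroup sg = record
  { unique = unique ; automorph = All.map (Product.map₂ λ mono i j → mono j i) automorph
  ; has-id = has-id ; closed-∘ = closed-∘ ; closed-⁻¹ = closed-⁻¹ }
  where open IsSubgroupOfAut sg

module SubgroupFacts {n : ℕ} (P : FinPoset n) (H : List (Perm n)) (sg : IsSubgroupOfAut P H) where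
  open FinPoset P
  open IsSubgroupOfAut sg public

  monotone : ∀ {σ} → σ ∈ H → ∀ i j → (i ≤ j) ⇔ (lookup σ i ≤ lookup σ j)
  monotone σ∈H = proj₂ (All.lookup automorph σ∈H)

  inverse-in : ∀ {σ} → σ ∈ H → ∃ λ τ → τ ∈ H × Inverses σ τ
  inverse-in {σ} σ∈H =
    let (τ , τ∈H , σ∘τ≡id) = closed-⁻¹ σ∈H
    in τ , τ∈H , inverses-from σ τ σ∘τ≡id (proj₁ (All.lookup automorph σ∈H))

  record Witness (K I : Subset n) : Set where
    field
      σ τ : Perm n
      σ∈H : σ ∈ H
      τ∈H : τ ∈ H
      inv : Inverses σ τ
      moves : image σ K ≡ I

  witness : ∀ {K I} → E H K I → Witness K I
  witness K~I =
    let (σ , σ∈H , σK≡I) = find K~I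
        (τ , τ∈H , inv) = inverse-in σ∈H
    in record { σ = σ ; τ = τ ; σ∈H = σ∈H ; τ∈H = τ∈H ; inv = inv ; moves = σK≡I }

  E-image : ∀ {σ} → σ ∈ H → ∀ K L → E H (image σ K) L ⇔ E H K L
  E-image {σ} σ∈H K L = mk⇔
    (λ e → let (ρ , ρ∈H , ρσK≡L) = find e in lose (closed-∘ ρ∈H σ∈H) (≡.trans (image-∘ₚ ρ σ K) ρσK≡L))
    (λ e → let (ρ , ρ∈H , ρK≡L) = find e
               (τ , τ∈H , inv) = inverse-in σ∈H in
      lose (closed-∘ ρ∈H τ∈H) (≡.trans (image-∘ₚ ρ τ (image σ K)) (≡.trans (≡.cong (image ρ) (image-inverse inv K)) ρK≡L)))


module FieldSums (F : FiniteField) (R : CharZeroField) where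
  open Sums R public
  open VectorsOver F public
  module F = FiniteField F

  fieldRing : CommutativeRing _ _
  fieldRing = record { isCommutativeRing = F.isCommutativeRing }
  module F-ring = CommutativeRing fieldRing
  module F-group = Algebra.Properties.Group F-ring.+-group

  ·-comm : ∀ {k} (u v : Vec F.Carrier k) → u · v ≡ v · u
  ·-comm [] [] = ≡.refl
  ·-comm (x ∷ u) (y ∷ v) = ≡.cong₂ F._+_ (F-ring.*-comm x y) (·-comm u v)

  allVecs-unique : ∀ n → Unique (allVecs n)
  allVecs-unique n = ≡.subst Unique (≡.sym (allVecs≡vecsOf F n)) (vecsOf-unique F.elements F.elements-unique n)

  allVecs-complete : ∀ {n} (v : Vec F.Carrier n) → v ∈ allVecs n
  allVecs-complete {n} v = ≡.subst (v ∈_) (≡.sym (allVecs≡vecsOf F n)) (vecsOf-complete F.elements F.elements-complete v)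

  Σ-allVecs-Π : ∀ n (f : Fin n → F.Carrier → Carrier) →
    Σ[ allVecs n ] (λ w → Π (λ i → f i (lookup w i))) ≈ Π (λ i → Σ[ F.elements ] (f i))
  Σ-allVecs-Π n f rewrite allVecs≡vecsOf F n = Σ-vecsOf-Π F.elements n f

  Σ-elements-reindex : (π π⁻¹ : F.Carrier → F.Carrier) → (∀ y → π (π⁻¹ y) ≡ y) → (∀ {x y} → π x ≡ π y → x ≡ y) →
    (f : F.Carrier → Carrier) → Σ[ F.elements ] (f ∘ π) ≈ Σ[ F.elements ] f
  Σ-elements-reindex π π⁻¹ π∘π⁻¹ π-inj f = Σ-reindex F.elements π f F.elements-unique π-inj
    (λ x _ → F.elements-complete (π x)) (λ y _ → π⁻¹ y , F.elements-complete _ , π∘π⁻¹ y)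

  Σ-allVecs-reindex : ∀ n (π π⁻¹ : Vec F.Carrier n → Vec F.Carrier n) → (∀ y → π (π⁻¹ y) ≡ y) →
    (∀ {x y} → π x ≡ π y → x ≡ y) → (f : Vec F.Carrier n → Carrier) → Σ[ allVecs n ] (f ∘ π) ≈ Σ[ allVecs n ] f
  Σ-allVecs-reindex n π π⁻¹ π∘π⁻¹ π-inj f = Σ-reindex (allVecs n) π f (allVecs-unique n) π-inj
    (λ x _ → allVecs-complete (π x)) (λ y _ → π⁻¹ y , allVecs-complete _ , π∘π⁻¹ y)

  isZero : F.Carrier → Bool
  isZero x = ⌊ x F.≟ F.0# ⌋

  Σ-at-zero : ∀ (h : F.Carrier → Carrier) → Σ[ F.elements ] (λ x → [ isZero x ]ᵇ * h x) ≈ h F.0#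
  Σ-at-zero h = Σ-δ F.elements isZero F.0# h F.elements-unique (F.elements-complete _)
    (λ y y≡0 → ⌊⌋-sound (y F.≟ F.0#) y≡0) (⌊⌋-complete (F.0# F.≟ F.0#) ≡.refl)

  Σ× : (F.Carrier → Carrier) → Carrier
  Σ× h = Σ[ F.elements ] (λ x → [ not (isZero x) ]ᵇ * h x)

  Σ-split : ∀ (h : F.Carrier → Carrier) → Σ[ F.elements ] h ≈ h F.0# + Σ× h
  Σ-split h = begin
    Σ[ F.elements ] h                                                          ≈⟨ Σ-cong F.elements split ⟩
    Σ[ F.elements ] (λ x → [ isZero x ]ᵇ * h x + [ not (isZero x) ]ᵇ * h x)  ≈⟨ Σ-+ F.elements _ _ ⟩
    Σ[ F.elements ] (λ x → [ isZero x ]ᵇ * h x) + Σ× h                        ≈⟨ +-congʳ (Σ-at-zero h) ⟩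
    h F.0# + Σ× h ∎
    where
    split : ∀ x → h x ≈ [ isZero x ]ᵇ * h x + [ not (isZero x) ]ᵇ * h x
    split x with isZero x
    ... | true = sym (trans (+-cong (*-identityˡ _) (zeroˡ _)) (+-identityʳ _))
    ... | false = sym (trans (+-cong (zeroˡ _) (*-identityˡ _)) (+-identityˡ _))

  Σ-by-zero : ∀ (α β : Bool) (h : F.Carrier → Carrier) →
    Σ[ F.elements ] (λ x → [ if isZero x then α else β ]ᵇ * h x) ≈ [ α ]ᵇ * h F.0# + [ β ]ᵇ * Σ× h
  Σ-by-zero α β h = begin
    Σ[ F.elements ] g    ≈⟨ Σ-split g ⟩
    g F.0# + Σ× g        ≈⟨ +-cong (*-congʳ (reflexive (≡.cong (λ z → [ if z then α else β ]ᵇ) at0)))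
                                   (Σ-cong F.elements pick) ⟩
    [ α ]ᵇ * h F.0# + Σ[ F.elements ] (λ x → [ β ]ᵇ * ([ not (isZero x) ]ᵇ * h x)) ≈⟨ +-congˡ (Σ-*ˡ F.elements _ _) ⟨
    [ α ]ᵇ * h F.0# + [ β ]ᵇ * Σ× h ∎
    where
    g = λ x → [ if isZero x then α else β ]ᵇ * h x
    at0 : isZero F.0# ≡ true
    at0 = ⌊⌋-complete (F.0# F.≟ F.0#) ≡.refl
    pick : ∀ x → [ not (isZero x) ]ᵇ * g x ≈ [ β ]ᵇ * ([ not (isZero x) ]ᵇ * h x)
    pick x with isZero x
    ... | true = trans (zeroˡ _) (sym (trans (*-congˡ (zeroˡ _)) (zeroʳ _)))
    ... | false = trans (*-identityˡ _) (*-congˡ (sym (*-identityˡ _)))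

  q-suc : ∃ λ k → F.q ≡ suc k
  q-suc with F.elements | F.elements-complete F.0#
  ... | _ ∷ xs | _ = length xs , ≡.refl

  q≈1+[q-1] : ι F.q ≈ 1# + ι (F.q ∸ 1)
  q≈1+[q-1] = reflexive (≡.trans (≡.cong ι (proj₂ q-suc)) (≡.cong (λ m → 1# + ι (m ∸ 1)) (≡.sym (proj₂ q-suc))))

  Σ×-one : Σ× (λ _ → 1#) ≈ ι (F.q ∸ 1)
  Σ×-one = +-cancelˡ 1# _ _ (begin
    1# + Σ× (λ _ → 1#)         ≈⟨ Σ-split (λ _ → 1#) ⟨
    Σ[ F.elements ] (λ _ → 1#) ≈⟨ trans (Σ-const F.elements 1#) (*-identityʳ _) ⟩
    ι F.q                      ≈⟨ q≈1+[q-1] ⟩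
    1# + ι (F.q ∸ 1)           ∎)

module CharacterSums (F : FiniteField) (R : CharZeroField) (χ : FiniteField.Carrier F → CharZeroField.Carrier R)
                     (chr : NontrivialAdditiveCharacter F R χ) where
  open FieldSums F R public
  open NontrivialAdditiveCharacter chr
  open import Algebra.Properties.Ring ring using ([y-z]x≈yx-zx)

  -- χ turns the dot product into a product over the coordinates
  -- (the factor χ 0 comes from the empty sum closing the dot product)
  χ-dot : ∀ {n} (u w : Vec F.Carrier n) → χ (u · w) ≈ Π (λ i → χ (lookup u i F.* lookup w i)) * χ F.0#
  χ-dot [] [] = sym (*-identityˡ _)
  χ-dot (x ∷ u) (y ∷ w) = trans (homomorphism _ _) (trans (*-congˡ (χ-dot u w)) (sym (*-assoc _ _ _)))

  Σχ≈0 : Σ[ F.elements ] χ ≈ 0#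
  Σχ≈0 = begin
    S                           ≈⟨ cancel-by-inverse (proj₂ (inverse (χ b - 1#) χb-1≉0)) S ⟨
    y * ((χ b - 1#) * S)        ≈⟨ *-congˡ ([y-z]x≈yx-zx S (χ b) 1#) ⟩
    y * (χ b * S - 1# * S)      ≈⟨ *-congˡ (+-cong translate (-‿cong (*-identityˡ S))) ⟩
    y * (S - S)                 ≈⟨ *-congˡ (-‿inverseʳ S) ⟩
    y * 0#                      ≈⟨ zeroʳ y ⟩
    0#                          ∎
    where
    S = Σ[ F.elements ] χ
    b = proj₁ nontrivial
    χb-1≉0 : ¬ (χ b - 1# ≈ 0#)
    χb-1≉0 = proj₂ nontrivial ∘ x∙y⁻¹≈ε⇒x≈y (χ b) 1#
    y = proj₁ (inverse (χ b - 1#) χb-1≉0)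
    -- translating by b permutes F_q
    translate : χ b * S ≈ S
    translate = begin
      χ b * S                                ≈⟨ Σ-*ˡ F.elements (χ b) χ ⟩
      Σ[ F.elements ] (λ a → χ b * χ a)      ≈⟨ Σ-cong F.elements (λ a → sym (homomorphism b a)) ⟩
      Σ[ F.elements ] (λ a → χ (b F.+ a))    ≈⟨ Σ-elements-reindex (b F.+_) (λ a → F.- b F.+ a) cancel inj χ ⟩
      S                                      ∎
      where
      cancel : ∀ a → b F.+ (F.- b F.+ a) ≡ a
      cancel a = ≡.trans (≡.sym (F-ring.+-assoc _ _ _))
        (≡.trans (≡.cong (F._+ a) (F-ring.-‿inverseʳ b)) (F-ring.+-identityˡ a))
      inj : ∀ {x y} → b F.+ x ≡ b F.+ y → x ≡ y
      inj {x} {y} = F-group.∙-cancelˡ b x y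

  -- orthogonality: for c ≠ 0, a ↦ c a permutes F_q
  Σχ-scaled : ∀ c → c ≢ F.0# → Σ[ F.elements ] (λ a → χ (c F.* a)) ≈ 0#
  Σχ-scaled c c≢0 = trans (Σ-elements-reindex (c F.*_) (d F.*_) (cancel c d cd≡1) inj χ) Σχ≈0
    where
    d = proj₁ (F.inverse c c≢0)
    cd≡1 = proj₂ (F.inverse c c≢0)
    cancel : ∀ x y → x F.* y ≡ F.1# → ∀ a → x F.* (y F.* a) ≡ a
    cancel x y xy≡1 a = ≡.trans (≡.sym (F-ring.*-assoc _ _ _)) (≡.trans (≡.cong (F._* a) xy≡1) (F-ring.*-identityˡ a))
    inj : ∀ {a b} → c F.* a ≡ c F.* b → a ≡ b
    inj {a} {b} ca≡cb = ≡.trans (≡.sym (cancel d c dc≡1 a)) (≡.trans (≡.cong (d F.*_) ca≡cb) (cancel d c dc≡1 b))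
      where dc≡1 = ≡.trans (F-ring.*-comm d c) cd≡1

  χ-c0 : ∀ c → χ (c F.* F.0#) ≈ χ F.0#
  χ-c0 c = reflexive (≡.cong χ (F-ring.zeroʳ c))

  Σ×χ-scaled : ∀ c → c ≢ F.0# → Σ× (λ a → χ (c F.* a)) ≈ - χ F.0#
  Σ×χ-scaled c c≢0 = trans (inverseʳ-unique _ _ (trans (sym (Σ-split _)) (Σχ-scaled c c≢0)))
                           (-‿cong (χ-c0 c))

module ClosureIndicator (F : FiniteField) (R : CharZeroField) {n : ℕ} (P : FinPoset n) where
  open FieldSums F R
  open PosetFacts P

  supp-lookup : ∀ (w : Vec F.Carrier n) i → lookup (supp w) i ≡ not (isZero (lookup w i))
  supp-lookup w i = Vecₚ.lookup-map i _ w

  -- The values allowed at coordinate i for a vector w with ⟨ supp w ⟩ = K: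
  -- 0 is allowed iff i is not maximal in K, a nonzero value iff i ∈ K.
  admissible : Subset n → Fin n → F.Carrier → Bool
  admissible K i x = if isZero x then not (lookup (M K) i) else lookup K i

  closure≡⇒admissible : ∀ K (w : Vec F.Carrier n) → ⟨ supp w ⟩ ≡ K → ∀ i → admissible K i (lookup w i) ≡ true
  closure≡⇒admissible K w eq i with closure-≡⇒ (supp w) K eq | isZero (lookup w i) in wi
  ... | _ , MK⊆supp | true = not-false (not-true-false λ i∈M →
        true≢false (≡.trans (≡.sym (MK⊆supp i i∈M)) (≡.trans (supp-lookup w i) (≡.cong not wi))))
  ... | supp⊆K , _ | false = supp⊆K i (≡.trans (supp-lookup w i) (≡.cong not wi))

  admissible⇒closure≡ : ∀ K (w : Vec F.Carrier n) → IsIdeal K → (∀ i → admissible K i (lookup w i) ≡ true) →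
    ⟨ supp w ⟩ ≡ K
  admissible⇒closure≡ K w K-ideal adm = closure-≡⇐ (supp w) K K-ideal supp⊆K MK⊆supp
    where
    supp⊆K : ∀ i → i ∈ₛ supp w → i ∈ₛ K
    supp⊆K i i∈ with isZero (lookup w i) in wi | adm i
    ... | false | i∈K = i∈K
    ... | true | _ = ⊥-elim (true≢false (≡.trans (≡.sym i∈) (≡.trans (supp-lookup w i) (≡.cong not wi))))
    MK⊆supp : ∀ i → i ∈ₛ M K → i ∈ₛ supp w
    MK⊆supp i i∈M with isZero (lookup w i) in wi | adm i
    ... | false | _ = ≡.trans (supp-lookup w i) (≡.cong not wi)
    ... | true | i∉M = ⊥-elim (true≢false (≡.trans (≡.sym i∈M) (not-true i∉M)))

  closure-indicator : ∀ K → IsIdeal K → ∀ (w : Vec F.Carrier n) →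
    [ ⌊ ⟨ supp w ⟩ ≟ₛ K ⌋ ]ᵇ ≈ Π (λ i → [ admissible K i (lookup w i) ]ᵇ)
  closure-indicator K K-ideal w = Π-indicator (⟨ supp w ⟩ ≟ₛ K) _
    (mk⇔ (closure≡⇒admissible K w) (admissible⇒closure≡ K w K-ideal))

  sphereCount : Subset n → Carrier
  sphereCount K = Σ[ allVecs n ] (λ w → [ ⌊ ⟨ supp w ⟩ ≟ₛ K ⌋ ]ᵇ * 1#)

  admissible-count : ∀ K i → Σ[ F.elements ] (λ x → [ admissible K i x ]ᵇ) ≈
    ι (if lookup (M K) i then F.q ∸ 1 else 1) * ι (if lookup (K ₘ) i then F.q else 1)
  admissible-count K i = begin
    Σ[ F.elements ] (λ x → [ admissible K i x ]ᵇ)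
      ≈⟨ Σ-cong F.elements (λ x → sym (*-identityʳ _)) ⟩
    Σ[ F.elements ] (λ x → [ admissible K i x ]ᵇ * 1#)
      ≈⟨ Σ-by-zero (not (lookup (M K) i)) (lookup K i) (λ _ → 1#) ⟩
    [ not (lookup (M K) i) ]ᵇ * 1# + [ lookup K i ]ᵇ * Σ× (λ _ → 1#)
      ≈⟨ +-cong (*-identityʳ _) (*-congˡ Σ×-one) ⟩
    [ not (lookup (M K) i) ]ᵇ + [ lookup K i ]ᵇ * ι (F.q ∸ 1)
      ≈⟨ by-cases (lookup (M K) i) (lookup K i) ≡.refl ≡.refl ⟩
    ι (if lookup (M K) i then F.q ∸ 1 else 1) * ι (if lookup (K ₘ) i then F.q else 1) ∎
    where
    by-cases : ∀ m k → lookup (M K) i ≡ m → lookup K i ≡ k →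
      [ not m ]ᵇ + [ k ]ᵇ * ι (F.q ∸ 1) ≈ ι (if m then F.q ∸ 1 else 1) * ι (if lookup (K ₘ) i then F.q else 1)
    by-cases true true i∈M i∈K rewrite ₘ-lookup K i | i∈M | i∈K
      = trans (+-identityˡ _) (trans (*-identityˡ _) (trans (sym (*-identityʳ _)) (*-congˡ (sym ι-1))))
    by-cases true false i∈M i∉K = ⊥-elim (true≢false (≡.trans (≡.sym (proj₁ (maximal-sound K i i∈M))) i∉K))
    by-cases false true i∉M i∈K rewrite ₘ-lookup K i | i∉M | i∈K
      = trans (+-congˡ (*-identityˡ _)) (trans (sym q≈1+[q-1]) (trans (sym (*-identityˡ _)) (*-congʳ (sym ι-1))))
    by-cases false false i∉M i∉K rewrite ₘ-lookup K i | i∉M | i∉K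
      = trans (+-congˡ (zeroˡ _)) (trans (+-identityʳ _) (trans (sym (*-identityˡ _)) (*-cong (sym ι-1) (sym ι-1))))

  sphereCount-formula : ∀ K → IsIdeal K → sphereCount K ≈ ι ((F.q ∸ 1) ^ ∣ M K ∣ ℕ.* F.q ^ ∣ K ₘ ∣)
  sphereCount-formula K K-ideal = begin
    sphereCount K
      ≈⟨ Σ-cong (allVecs n) (λ w → trans (*-identityʳ _) (closure-indicator K K-ideal w)) ⟩
    Σ[ allVecs n ] (λ w → Π (λ i → [ admissible K i (lookup w i) ]ᵇ))
      ≈⟨ Σ-allVecs-Π n (λ i x → [ admissible K i x ]ᵇ) ⟩
    Π (λ i → Σ[ F.elements ] (λ x → [ admissible K i x ]ᵇ))
      ≈⟨ Π-cong (admissible-count K) ⟩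
    Π (λ i → ι (if lookup (M K) i then F.q ∸ 1 else 1) * ι (if lookup (K ₘ) i then F.q else 1))
      ≈⟨ Π-mul (λ i → ι (if lookup (M K) i then F.q ∸ 1 else 1)) (λ i → ι (if lookup (K ₘ) i then F.q else 1)) ⟩
    Π (λ i → ι (if lookup (M K) i then F.q ∸ 1 else 1)) * Π (λ i → ι (if lookup (K ₘ) i then F.q else 1))
      ≈⟨ *-cong (Π-power (M K) (F.q ∸ 1)) (Π-power (K ₘ) F.q) ⟩
    ι ((F.q ∸ 1) ^ ∣ M K ∣) * ι (F.q ^ ∣ K ₘ ∣)
      ≈⟨ ι-* ((F.q ∸ 1) ^ ∣ M K ∣) (F.q ^ ∣ K ₘ ∣) ⟨
    ι ((F.q ∸ 1) ^ ∣ M K ∣ ℕ.* F.q ^ ∣ K ₘ ∣) ∎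

module CoordinateAction (F : FiniteField) {n : ℕ} where
  open VectorsOver F
  private module F = FiniteField F

  -- (τ ⋆ y)_j = y_(τ j); for σ with inverse τ this moves supports by σ
  _⋆_ : Perm n → Vec F.Carrier n → Vec F.Carrier n
  τ ⋆ y = tabulate (λ j → lookup y (lookup τ j))

  ⋆-lookup : ∀ τ y j → lookup (τ ⋆ y) j ≡ lookup y (lookup τ j)
  ⋆-lookup τ y j = Vecₚ.lookup∘tabulate _ j

  ⋆-inverse : ∀ {σ τ} → Inverses σ τ → ∀ y → τ ⋆ (σ ⋆ y) ≡ y
  ⋆-inverse {σ} {τ} inv y = vec-ext λ j →
    ≡.trans (⋆-lookup τ (σ ⋆ y) j) (≡.trans (⋆-lookup σ y (lookup τ j)) (≡.cong (lookup y) (Inverses.σ∘τ inv j)))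

  ⋆-injective : ∀ {σ τ} → Inverses σ τ → ∀ {x y} → τ ⋆ x ≡ τ ⋆ y → x ≡ y
  ⋆-injective {σ} inv {x} {y} eq =
    ≡.trans (≡.sym (⋆-inverse (inverses-sym inv) x)) (≡.trans (≡.cong (σ ⋆_) eq) (⋆-inverse (inverses-sym inv) y))

  supp-⋆ : ∀ {σ τ} → Inverses σ τ → ∀ y → supp (τ ⋆ y) ≡ image σ (supp y)
  supp-⋆ {σ} {τ} inv y = vec-ext λ j → begin
    lookup (supp (τ ⋆ y)) j                   ≡⟨ Vecₚ.lookup-map j _ (τ ⋆ y) ⟩
    not ⌊ lookup (τ ⋆ y) j F.≟ F.0# ⌋          ≡⟨ ≡.cong (λ x → not ⌊ x F.≟ F.0# ⌋) (⋆-lookup τ y j) ⟩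
    not ⌊ lookup y (lookup τ j) F.≟ F.0# ⌋     ≡⟨ Vecₚ.lookup-map (lookup τ j) _ y ⟨
    lookup (supp y) (lookup τ j)              ≡⟨ image-lookup inv (supp y) j ⟨
    lookup (image σ (supp y)) j               ∎
    where open ≡.≡-Reasoning

  closure-⋆ : ∀ (Q : FinPoset n) {σ τ} → Inverses σ τ →
    (∀ i j → (FinPoset._≤_ Q i j) ⇔ (FinPoset._≤_ Q (lookup σ i) (lookup σ j))) →
    ∀ y → PosetFacts.⟨_⟩ Q (supp (τ ⋆ y)) ≡ image σ (PosetFacts.⟨_⟩ Q (supp y))
  closure-⋆ Q inv σ-mono y = ≡.trans (≡.cong (PosetFacts.⟨_⟩ Q) (supp-⋆ inv y)) (closure-image Q inv σ-mono (supp y))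

module CharacterAction (F : FiniteField) (R : CharZeroField) (χ : FiniteField.Carrier F → CharZeroField.Carrier R)
                       (chr : NontrivialAdditiveCharacter F R χ) {n : ℕ} where
  open CharacterSums F R χ chr
  open CoordinateAction F {n}

  χ-⋆ : ∀ {σ τ} → Inverses σ τ → ∀ a w → χ ((τ ⋆ a) · (τ ⋆ w)) ≈ χ (a · w)
  χ-⋆ {σ} {τ} inv a w = begin
    χ ((τ ⋆ a) · (τ ⋆ w))                                         ≈⟨ χ-dot (τ ⋆ a) (τ ⋆ w) ⟩
    Π (λ i → χ (lookup (τ ⋆ a) i F.* lookup (τ ⋆ w) i)) * χ F.0#
      ≈⟨ *-congʳ (Π-cong (λ i → reflexive (≡.cong₂ (λ x y → χ (x F.* y)) (⋆-lookup τ a i) (⋆-lookup τ w i)))) ⟩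
    Π (λ i → χ (lookup a (lookup τ i) F.* lookup w (lookup τ i))) * χ F.0#
      ≈⟨ *-congʳ (Π-reindex (lookup τ) (lookup σ) τ∘σ σ∘τ (λ i → χ (lookup a i F.* lookup w i))) ⟩
    Π (λ i → χ (lookup a i F.* lookup w i)) * χ F.0#              ≈⟨ χ-dot a w ⟨
    χ (a · w)                                                     ∎
    where open Inverses inv

module SphereCounting (F : FiniteField) (R : CharZeroField) {n : ℕ} (P : FinPoset n)
                      (H : List (Perm n)) (sg : IsSubgroupOfAut P H) where
  open FieldSums F R
  open CoordinateAction F {n}
  open SubgroupFacts P H sg
  open ClosureIndicator F R P
  open PosetFacts P using (⟨_⟩; IsIdeal; M; _ₘ)
  open Spheres P H using (S)

  sphereCount-invariant : ∀ K I → E H K I → sphereCount K ≈ sphereCount I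
  sphereCount-invariant K I K~I = begin
    sphereCount K                                               ≈⟨ Σ-cong (allVecs n) moved ⟩
    Σ[ allVecs n ] (λ w → [ ⌊ ⟨ supp (τ ⋆ w) ⟩ ≟ₛ I ⌋ ]ᵇ * 1#)  ≈⟨ Σ-allVecs-reindex n (τ ⋆_) (σ ⋆_)
                                                                     (⋆-inverse inv) (⋆-injective inv) _ ⟩
    sphereCount I                                               ∎
    where
    open Witness (witness {K} {I} K~I)
    X≡K⇔σX≡I : ∀ X → X ≡ K ⇔ image σ X ≡ I
    X≡K⇔σX≡I X = mk⇔
      (λ X≡K → ≡.trans (≡.cong (image σ) X≡K) moves)
      (λ σX≡I → ≡.trans (≡.sym (image-inverse inv X))
                  (≡.trans (≡.cong (image τ) (≡.trans σX≡I (≡.sym moves))) (image-inverse inv K)))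
    moved : ∀ w → [ ⌊ ⟨ supp w ⟩ ≟ₛ K ⌋ ]ᵇ * 1# ≈ [ ⌊ ⟨ supp (τ ⋆ w) ⟩ ≟ₛ I ⌋ ]ᵇ * 1#
    moved w = *-congʳ (reflexive (≡.cong [_]ᵇ (≡.trans
      (⌊⌋-⇔ (⟨ supp w ⟩ ≟ₛ K) (image σ ⟨ supp w ⟩ ≟ₛ I) (X≡K⇔σX≡I ⟨ supp w ⟩))
      (≡.cong (λ X → ⌊ X ≟ₛ I ⌋) (≡.sym (closure-⋆ P inv (monotone σ∈H) w))))))

  orbitSize : Subset n → Carrier
  orbitSize I = Σ[ allSubsets n ] (λ K → [ ⌊ E? H K I ⌋ ]ᵇ * 1#)

  -- |S_Ī| = |orbit of I| · N(I), splitting S_Ī by the ideal generated by the support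
  sphere-size : ∀ I → ι (length (S I)) ≈ orbitSize I * sphereCount I
  sphere-size I = begin
    ι (length (S I))                                              ≈⟨ ι-count (λ y → E? H ⟨ supp y ⟩ I) (allVecs n) ⟩
    Σ[ allVecs n ] (λ y → [ ⌊ E? H ⟨ supp y ⟩ I ⌋ ]ᵇ * 1#)        ≈⟨ Σ-fibres (allVecs n) (λ y → ⟨ supp y ⟩) (λ K → ⌊ E? H K I ⌋) (λ _ → 1#) ⟩
    Σ[ allSubsets n ] (λ K → [ ⌊ E? H K I ⌋ ]ᵇ * sphereCount K)   ≈⟨ Σ-cong (allSubsets n) on-orbit ⟩
    Σ[ allSubsets n ] (λ K → [ ⌊ E? H K I ⌋ ]ᵇ * 1# * sphereCount I) ≈⟨ Σ-*ʳ (allSubsets n) _ _ ⟨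
    orbitSize I * sphereCount I                                   ∎
    where
    on-orbit : ∀ K → [ ⌊ E? H K I ⌋ ]ᵇ * sphereCount K ≈ [ ⌊ E? H K I ⌋ ]ᵇ * 1# * sphereCount I
    on-orbit K with E? H K I
    ... | yes K~I = trans (*-congˡ (sphereCount-invariant K I K~I)) (*-congʳ (sym (*-identityʳ _)))
    ... | no _ = trans (zeroˡ _) (sym (trans (*-congʳ (zeroˡ _)) (zeroˡ _)))

  carrierCount : Subset n → Subset n → Carrier
  carrierCount K I = Σ[ H ] (λ ρ → [ ⌊ image ρ K ≟ₛ I ⌋ ]ᵇ * 1#)

  -- if some σ₀ ∈ H carries K to I, then ρ ↦ ρ ∘ σ₀ matches Stab(I) with the carriers of K to I
  carrierCount-stabilizer : ∀ K I → E H K I → carrierCount K I ≈ carrierCount I I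
  carrierCount-stabilizer K I K~I = sym (begin
    carrierCount I I                                          ≈⟨ Σ-cong H (λ ρ → reflexive (≡.cong (λ X → [ ⌊ X ≟ₛ I ⌋ ]ᵇ * 1#) (shift ρ))) ⟩
    Σ[ H ] (λ ρ → [ ⌊ image (ρ ∘ₚ σ) K ≟ₛ I ⌋ ]ᵇ * 1#)       ≈⟨ Σ-reindex H (_∘ₚ σ) (λ ρ → [ ⌊ image ρ K ≟ₛ I ⌋ ]ᵇ * 1#)
                                                                   unique inj (λ ρ ρ∈H → closed-∘ ρ∈H σ∈H) onto ⟩
    carrierCount K I                                          ∎)
    where
    open Witness (witness {K} {I} K~I)
    shift : ∀ ρ → image ρ I ≡ image (ρ ∘ₚ σ) K
    shift ρ = ≡.trans (≡.cong (image ρ) (≡.sym moves)) (≡.sym (image-∘ₚ ρ σ K))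
    cancel : ∀ {α β} → Inverses α β → ∀ ρ → (ρ ∘ₚ α) ∘ₚ β ≡ ρ
    cancel {α} {β} inv′ ρ = ≡.trans (∘ₚ-assoc ρ α β) (≡.trans (≡.cong (ρ ∘ₚ_) (Inverses.composite inv′)) (∘ₚ-identityʳ ρ))
    inj : ∀ {ρ ρ′} → ρ ∘ₚ σ ≡ ρ′ ∘ₚ σ → ρ ≡ ρ′
    inj {ρ} {ρ′} eq = ≡.trans (≡.sym (cancel inv ρ)) (≡.trans (≡.cong (_∘ₚ τ) eq) (cancel inv ρ′))
    onto : ∀ ρ → ρ ∈ H → ∃ λ ρ′ → ρ′ ∈ H × ρ′ ∘ₚ σ ≡ ρ
    onto ρ ρ∈H = ρ ∘ₚ τ , closed-∘ ρ∈H τ∈H , cancel (inverses-sym inv) ρ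

  orbit-stabilizer : ∀ I → orbitSize I * ι (stabSize H I) ≈ ι (length H)
  orbit-stabilizer I = sym (begin
    ι (length H)                                                    ≈⟨ trans (sym (*-identityʳ _)) (sym (Σ-const H 1#)) ⟩
    Σ[ H ] (λ _ → 1#)                                               ≈⟨ Σ-cong∈ H one-preimage ⟨
    Σ[ H ] (λ ρ → Σ[ allSubsets n ] (λ K → [ ⌊ image ρ K ≟ₛ I ⌋ ]ᵇ * 1#)) ≈⟨ Σ-swap H (allSubsets n) _ ⟩
    Σ[ allSubsets n ] (λ K → carrierCount K I)                      ≈⟨ Σ-cong (allSubsets n) on-orbit ⟩
    Σ[ allSubsets n ] (λ K → [ ⌊ E? H K I ⌋ ]ᵇ * 1# * carrierCount I I) ≈⟨ Σ-*ʳ (allSubsets n) _ _ ⟨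
    orbitSize I * carrierCount I I                                  ≈⟨ *-congˡ (ι-count (λ ρ → image ρ I ≟ₛ I) H) ⟨
    orbitSize I * ι (stabSize H I)                                  ∎)
    where
    -- each ρ ∈ H carries exactly one subset, namely ρ⁻¹(I), to I
    one-preimage : ∀ ρ → ρ ∈ H → Σ[ allSubsets n ] (λ K → [ ⌊ image ρ K ≟ₛ I ⌋ ]ᵇ * 1#) ≈ 1#
    one-preimage ρ ρ∈H = Σ-δ (allSubsets n) (λ K → ⌊ image ρ K ≟ₛ I ⌋) (image τ I) (λ _ → 1#)
      (allSubsets-unique n) (allSubsets-complete _)
      (λ K ρK≡I → ≡.trans (≡.sym (image-inverse inv K)) (≡.cong (image τ) (⌊⌋-sound (image ρ K ≟ₛ I) ρK≡I)))
      (⌊⌋-complete (image ρ (image τ I) ≟ₛ I) (image-inverse (inverses-sym inv) I))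
      where
      τ = proj₁ (inverse-in ρ∈H)
      inv = proj₂ (proj₂ (inverse-in ρ∈H))
    on-orbit : ∀ K → carrierCount K I ≈ [ ⌊ E? H K I ⌋ ]ᵇ * 1# * carrierCount I I
    on-orbit K with E? H K I
    ... | yes K~I = trans (carrierCount-stabilizer K I K~I) (sym (trans (*-congʳ (*-identityˡ 1#)) (*-identityˡ _)))
    ... | no K≁I = trans (Σ-cong∈ H none) (trans (Σ-zero H) (sym (trans (*-congʳ (zeroˡ _)) (zeroˡ _))))
      where
      none : ∀ ρ → ρ ∈ H → [ ⌊ image ρ K ≟ₛ I ⌋ ]ᵇ * 1# ≈ 0#
      none ρ ρ∈H with image ρ K ≟ₛ I
      ... | yes ρK≡I = ⊥-elim (K≁I (lose ρ∈H ρK≡I))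
      ... | no _ = zeroˡ _

  stabilizer-sphere : ∀ I → IsIdeal I →
    ι (stabSize H I) * ι (length (S I)) ≈ ι (length H) * ι ((F.q ∸ 1) ^ ∣ M I ∣ ℕ.* F.q ^ ∣ I ₘ ∣)
  stabilizer-sphere I I-ideal = begin
    ι (stabSize H I) * ι (length (S I))                 ≈⟨ *-congˡ (sphere-size I) ⟩
    ι (stabSize H I) * (orbitSize I * sphereCount I)    ≈⟨ *-assoc _ _ _ ⟨
    (ι (stabSize H I) * orbitSize I) * sphereCount I    ≈⟨ *-cong (trans (*-comm _ _) (orbit-stabilizer I))
                                                                   (sphereCount-formula I I-ideal) ⟩
    ι (length H) * ι ((F.q ∸ 1) ^ ∣ M I ∣ ℕ.* F.q ^ ∣ I ₘ ∣) ∎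

module SphereSums (F : FiniteField) (R : CharZeroField) (χ : FiniteField.Carrier F → CharZeroField.Carrier R)
                  (chr : NontrivialAdditiveCharacter F R χ) {n : ℕ} (P : FinPoset n)
                  (H : List (Perm n)) (sg : IsSubgroupOfAut P H) where
  open CharacterSums F R χ chr
  open CharacterAction F R χ chr {n}
  open CoordinateAction F {n}
  open SubgroupFacts P H sg
  open FinPoset P using (_≤_)
  open IsDecPartialOrder (FinPoset.isDecPartialOrder P) using () renaming (refl to ≤-refl)
  module 𝒫 = PosetFacts P
  module 𝒫* = PosetFacts (dual P)
  open ClosureIndicator F R (dual P) using (admissible; closure-indicator; supp-lookup)
  open Spheres P H using (InS; S*)

  sphereSum : Subset n → Vec F.Carrier n → Carrier
  sphereSum L a = Σ[ allVecs n ] (λ w → [ ⌊ E? H 𝒫*.⟨ supp w ⟩ L ⌋ ]ᵇ * χ (a · w))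

  sphereSum-⋆ : ∀ {σ τ} → σ ∈ H → Inverses σ τ → ∀ L a → sphereSum L (τ ⋆ a) ≈ sphereSum L a
  sphereSum-⋆ {σ} {τ} σ∈H inv L a = begin
    sphereSum L (τ ⋆ a)
      ≈⟨ Σ-allVecs-reindex n (τ ⋆_) (σ ⋆_) (⋆-inverse inv) (⋆-injective inv) _ ⟨
    Σ[ allVecs n ] (λ w → [ ⌊ E? H 𝒫*.⟨ supp (τ ⋆ w) ⟩ L ⌋ ]ᵇ * χ ((τ ⋆ a) · (τ ⋆ w)))
      ≈⟨ Σ-cong (allVecs n) (λ w → *-cong (reflexive (≡.cong [_]ᵇ (class w))) (χ-⋆ inv a w)) ⟩
    sphereSum L a ∎
    where
    class : ∀ w → ⌊ E? H 𝒫*.⟨ supp (τ ⋆ w) ⟩ L ⌋ ≡ ⌊ E? H 𝒫*.⟨ supp w ⟩ L ⌋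
    class w = ≡.trans (≡.cong (λ X → ⌊ E? H X L ⌋) (closure-⋆ (dual P) inv (λ i j → monotone σ∈H j i) w))
                      (⌊⌋-⇔ (E? H (image σ 𝒫*.⟨ supp w ⟩) L) (E? H 𝒫*.⟨ supp w ⟩ L) (E-image σ∈H 𝒫*.⟨ supp w ⟩ L))

  fibreSum : Vec F.Carrier n → Subset n → Carrier
  fibreSum a K = Σ[ allVecs n ] (λ w → [ ⌊ 𝒫*.⟨ supp w ⟩ ≟ₛ K ⌋ ]ᵇ * χ (a · w))

  coordSum : Subset n → Fin n → F.Carrier → Carrier
  coordSum K i c = Σ[ F.elements ] (λ x → [ admissible K i x ]ᵇ * χ (c F.* x))

  fibreSum-product : ∀ a K → 𝒫*.IsIdeal K → fibreSum a K ≈ Π (λ i → coordSum K i (lookup a i)) * χ F.0#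
  fibreSum-product a K K-ideal = begin
    fibreSum a K
      ≈⟨ Σ-cong (allVecs n) (λ w → *-cong (closure-indicator K K-ideal w) (χ-dot a w)) ⟩
    Σ[ allVecs n ] (λ w → Π (λ i → [ adm w i ]ᵇ) * (Π (λ i → χ (lookup a i F.* lookup w i)) * χ F.0#))
      ≈⟨ Σ-cong (allVecs n) (λ w → trans (sym (*-assoc _ _ _)) (*-congʳ (sym (Π-mul (λ i → [ adm w i ]ᵇ) _)))) ⟩
    Σ[ allVecs n ] (λ w → Π (λ i → [ adm w i ]ᵇ * χ (lookup a i F.* lookup w i)) * χ F.0#)
      ≈⟨ Σ-*ʳ (allVecs n) _ _ ⟨
    Σ[ allVecs n ] (λ w → Π (λ i → [ adm w i ]ᵇ * χ (lookup a i F.* lookup w i))) * χ F.0#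
      ≈⟨ *-congʳ (Σ-allVecs-Π n (λ i x → [ admissible K i x ]ᵇ * χ (lookup a i F.* x))) ⟩
    Π (λ i → coordSum K i (lookup a i)) * χ F.0# ∎
    where
    adm : Vec F.Carrier n → Fin n → Bool
    adm w i = admissible K i (lookup w i)

  coordSum-split : ∀ K i c → coordSum K i c ≈ [ not (lookup (𝒫*.M K) i) ]ᵇ * χ F.0# + [ lookup K i ]ᵇ * Σ× (λ x → χ (c F.* x))
  coordSum-split K i c = trans (Σ-by-zero _ _ _) (+-congʳ (*-congˡ (χ-c0 c)))

  coordSum-zeroTest : ∀ K i c c′ → isZero c ≡ isZero c′ → coordSum K i c ≈ coordSum K i c′
  coordSum-zeroTest K i c c′ same with c F.≟ F.0# | c′ F.≟ F.0#
  ... | yes c≡0 | yes c′≡0 = reflexive (≡.cong (coordSum K i) (≡.trans c≡0 (≡.sym c′≡0)))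
  ... | no c≢0 | no c′≢0 = trans (coordSum-split K i c) (trans (+-congˡ (*-congˡ
        (trans (Σ×χ-scaled c c≢0) (sym (Σ×χ-scaled c′ c′≢0))))) (sym (coordSum-split K i c′)))
  ... | yes _ | no _ = ⊥-elim (true≢false same)
  ... | no _ | yes _ = ⊥-elim (true≢false (≡.sym same))

  coordSum-outside : ∀ K i c c′ → lookup K i ≡ false → coordSum K i c ≈ coordSum K i c′
  coordSum-outside K i c c′ i∉K = trans (coordSum-split K i c) (trans (+-congˡ (trans (*-congʳ [K]≈0)
    (trans (zeroˡ _) (sym (trans (*-congʳ [K]≈0) (zeroˡ _)))))) (sym (coordSum-split K i c′)))
    where [K]≈0 = reflexive (≡.cong [_]ᵇ i∉K)

  coordSum-inner : ∀ K i c → i ∈ₛ K → lookup (𝒫*.M K) i ≡ false → c ≢ F.0# → coordSum K i c ≈ 0#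
  coordSum-inner K i c i∈K i∉M c≢0 = begin
    coordSum K i c                                                          ≈⟨ coordSum-split K i c ⟩
    [ not (lookup (𝒫*.M K) i) ]ᵇ * χ F.0# + [ lookup K i ]ᵇ * Σ× (λ x → χ (c F.* x))
      ≈⟨ +-cong (*-congʳ (reflexive (≡.cong (λ b → [ not b ]ᵇ) i∉M))) (*-cong (reflexive (≡.cong [_]ᵇ i∈K)) (Σ×χ-scaled c c≢0)) ⟩
    1# * χ F.0# + 1# * - χ F.0#                                             ≈⟨ +-cong (*-identityˡ _) (*-identityˡ _) ⟩
    χ F.0# - χ F.0#                                                         ≈⟨ -‿inverseʳ _ ⟩
    0# ∎

  Obstructed : Vec F.Carrier n → Subset n → Set
  Obstructed a K = ∃ λ i → i ∈ₛ K × lookup (𝒫*.M K) i ≡ false × i ∈ₛ supp a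

  obstructed? : ∀ a K → Dec (Obstructed a K)
  obstructed? a K = Finₚ.any? λ i →
    (lookup K i Bool.≟ true) ×-dec (lookup (𝒫*.M K) i Bool.≟ false) ×-dec (lookup (supp a) i Bool.≟ true)

  -- an obstruction makes a factor, hence the fibre sum, vanish
  obstructed-fibreSum : ∀ a K → 𝒫*.IsIdeal K → Obstructed a K → fibreSum a K ≈ 0#
  obstructed-fibreSum a K K-ideal (i , i∈K , i∉M , i∈supp) = trans (fibreSum-product a K K-ideal)
    (trans (*-congʳ (Π-zero _ i (coordSum-inner K i _ i∈K i∉M nonzero))) (zeroˡ _))
    where
    nonzero : lookup a i ≢ F.0#
    nonzero ai≡0 = true≢false (≡.trans (≡.sym i∈supp)
      (≡.trans (supp-lookup a i) (≡.cong not (⌊⌋-complete (lookup a i F.≟ F.0#) ai≡0))))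

  module _ (a b : Vec F.Carrier n) (same : 𝒫.⟨ supp a ⟩ ≡ 𝒫.⟨ supp b ⟩) (K : Subset n) (K-ideal : 𝒫*.IsIdeal K) where

    above-in-support : ∀ i → i ∈ₛ K → i ∈ₛ supp a → ∃ λ s → s ∈ₛ supp b × s ∈ₛ K × i ≤ s
    above-in-support i i∈K i∈supp =
      let (s , s∈supp , i≤s) = 𝒫.closure-sound (supp b) i (≡.subst (i ∈ₛ_) same (𝒫.closure-complete (supp a) i i i∈supp ≤-refl))
      in s , s∈supp , K-ideal i s i≤s i∈K , i≤s

    obstruction-transfer : Obstructed a K → Obstructed b K
    obstruction-transfer (i , i∈K , i∉M , i∈supp) with above-in-support i i∈K i∈supp
    ... | s , s∈supp , s∈K , i≤s with lookup (𝒫*.M K) s in sM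
    ...   | false = s , s∈K , sM , s∈supp
    ...   | true = ⊥-elim (true≢false (≡.trans (≡.sym sM)
                    (≡.subst (λ t → lookup (𝒫*.M K) t ≡ false) (≡.sym (proj₂ (𝒫*.maximal-sound K s sM) i i∈K i≤s)) i∉M)))

    minimal-transfer : ¬ Obstructed b K → ∀ i → i ∈ₛ 𝒫*.M K → i ∈ₛ supp a → i ∈ₛ supp b
    minimal-transfer unobstructed i i∈M i∈supp with above-in-support i (proj₁ (𝒫*.maximal-sound K i i∈M)) i∈supp
    ... | s , s∈supp , s∈K , i≤s with lookup (𝒫*.M K) s in sM
    ...   | false = ⊥-elim (unobstructed (s , s∈K , sM , s∈supp))
    ...   | true = ≡.subst (_∈ₛ supp b) (proj₂ (𝒫*.maximal-sound K s sM) i (proj₁ (𝒫*.maximal-sound K i i∈M)) i≤s) s∈supp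

  fibreSum-closure : ∀ a b K → 𝒫.⟨ supp a ⟩ ≡ 𝒫.⟨ supp b ⟩ → 𝒫*.IsIdeal K → fibreSum a K ≈ fibreSum b K
  fibreSum-closure a b K same K-ideal with obstructed? a K
  ... | yes obstructed = trans (obstructed-fibreSum a K K-ideal obstructed)
        (sym (obstructed-fibreSum b K K-ideal (obstruction-transfer a b same K K-ideal obstructed)))
  ... | no a-free = trans (fibreSum-product a K K-ideal)
        (trans (*-congʳ (Π-cong coordinate)) (sym (fibreSum-product b K K-ideal)))
    where
    b-free : ¬ Obstructed b K
    b-free = a-free ∘ obstruction-transfer b a (≡.sym same) K K-ideal
    supports-agree : ∀ i → i ∈ₛ K → lookup (supp a) i ≡ lookup (supp b) i
    supports-agree i i∈K with lookup (𝒫*.M K) i in iM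
    ... | true = ⇔→≡ (mk⇔ (minimal-transfer a b same K K-ideal b-free i iM) (minimal-transfer b a (≡.sym same) K K-ideal a-free i iM))
    ... | false = ≡.trans (not-true-false (λ i∈a → a-free (i , i∈K , iM , i∈a)))
                          (≡.sym (not-true-false (λ i∈b → b-free (i , i∈K , iM , i∈b))))
    coordinate : ∀ i → coordSum K i (lookup a i) ≈ coordSum K i (lookup b i)
    coordinate i = by-membership (lookup K i) ≡.refl
      where
      by-membership : ∀ k → lookup K i ≡ k → coordSum K i (lookup a i) ≈ coordSum K i (lookup b i)
      by-membership false i∉K = coordSum-outside K i _ _ i∉K
      by-membership true i∈K = coordSum-zeroTest K i _ _
        (not-injective (≡.trans (≡.sym (supp-lookup a i)) (≡.trans (supports-agree i i∈K) (supp-lookup b i))))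

  sphereSum-closure : ∀ L a b → 𝒫.⟨ supp a ⟩ ≡ 𝒫.⟨ supp b ⟩ → sphereSum L a ≈ sphereSum L b
  sphereSum-closure L a b same = begin
    sphereSum L a                                                           ≈⟨ Σ-fibres (allVecs n) (λ w → 𝒫*.⟨ supp w ⟩) (λ K → ⌊ E? H K L ⌋) (λ w → χ (a · w)) ⟩
    Σ[ allSubsets n ] (λ K → [ ⌊ E? H K L ⌋ ]ᵇ * fibreSum a K)             ≈⟨ Σ-cong (allSubsets n) (λ K → *-congˡ (fibre K)) ⟩
    Σ[ allSubsets n ] (λ K → [ ⌊ E? H K L ⌋ ]ᵇ * fibreSum b K)             ≈⟨ Σ-fibres (allVecs n) (λ w → 𝒫*.⟨ supp w ⟩) (λ K → ⌊ E? H K L ⌋) (λ w → χ (b · w)) ⟨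
    sphereSum L b ∎
    where
    -- a subset generated by no vector contributes nothing; one generated by some w is an ideal
    fibre : ∀ K → fibreSum a K ≈ fibreSum b K
    fibre K with any? (λ w → 𝒫*.⟨ supp w ⟩ ≟ₛ K) (allVecs n)
    ... | yes generated = let (w , _ , w↦K) = find generated in
          fibreSum-closure a b K same (≡.subst 𝒫*.IsIdeal w↦K (𝒫*.closure-ideal (supp w)))
    ... | no ungenerated = trans (empty a) (sym (empty b))
      where
      empty : ∀ c → fibreSum c K ≈ 0#
      empty c = trans (Σ-cong∈ (allVecs n) vanish) (Σ-zero (allVecs n))
        where
        vanish : ∀ w → w ∈ allVecs n → [ ⌊ 𝒫*.⟨ supp w ⟩ ≟ₛ K ⌋ ]ᵇ * χ (c · w) ≈ 0#
        vanish w w∈ with 𝒫*.⟨ supp w ⟩ ≟ₛ K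
        ... | yes w↦K = ⊥-elim (ungenerated (lose w∈ w↦K))
        ... | no _ = zeroˡ _

  sphereSum-independent : ∀ I L u u′ → InS I u → InS I u′ → Σ[ S* L ] (λ w → χ (u · w)) ≈ Σ[ S* L ] (λ w → χ (u′ · w))
  sphereSum-independent I L u u′ u∈S u′∈S = begin
    Σ[ S* L ] (λ w → χ (u · w))  ≈⟨ Σ-filter _ (allVecs n) _ ⟩
    sphereSum L u                ≈⟨ sphereSum-⋆ W.σ∈H W.inv L u ⟨
    sphereSum L (W.τ ⋆ u)        ≈⟨ sphereSum-closure L (W.τ ⋆ u) (W′.τ ⋆ u′) (≡.trans (normalise {u} (witness u∈S)) (≡.sym (normalise {u′} (witness u′∈S)))) ⟩
    sphereSum L (W′.τ ⋆ u′)      ≈⟨ sphereSum-⋆ W′.σ∈H W′.inv L u′ ⟩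
    sphereSum L u′               ≈⟨ Σ-filter _ (allVecs n) _ ⟨
    Σ[ S* L ] (λ w → χ (u′ · w)) ∎
    where
    module W = Witness (witness {𝒫.⟨ supp u ⟩} {I} u∈S)
    module W′ = Witness (witness {𝒫.⟨ supp u′ ⟩} {I} u′∈S)
    -- moving a vector of S_Ī by the inverse of its witness makes its support generate I itself
    normalise : ∀ {y} (V : Witness 𝒫.⟨ supp y ⟩ I) → 𝒫.⟨ supp (Witness.τ V ⋆ y) ⟩ ≡ I
    normalise {y} V = ≡.trans (closure-⋆ P (Witness.inv V) (monotone (Witness.σ∈H V)) y) (Witness.moves V)

member⇒NonZero : ∀ {A : Set} {x : A} {xs} → x ∈ xs → NonZero (length xs)
member⇒NonZero {xs = _ ∷ _} _ = ℕ.nonZero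

corollary4p2 :
  (F : FiniteField) (R : CharZeroField)
  (χ : FiniteField.Carrier F → CharZeroField.Carrier R) →
  NontrivialAdditiveCharacter F R χ →
  (n : ℕ) (P : FinPoset n) (H : List (Perm n)) → IsSubgroupOfAut P H →
  let q = FiniteField.q F
      open CharZeroField R
      open VectorsOver F
      open Spheres P H
  in
  (I J : Subset n) → 𝒫.IsIdeal I → 𝒫.IsIdeal J →
  (u v : Vec (FiniteField.Carrier F) n) → InS I u → InS* (J ᶜ) v →
  -- P_{J^c,I} computed at u,  Q_{I,J^c} computed at v
  let Pval = Σ[ S* (J ᶜ) ] (λ w → χ (u · w))
      Qval = Σ[ S I ] (λ w → χ (w · v))
      denI  = (q ∸ 1) ^ ∣ 𝒫.M I ∣ ℕ.* q ^ ∣ 𝒫._ₘ I ∣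
      denJc = (q ∸ 1) ^ ∣ 𝒫*.M (J ᶜ) ∣ ℕ.* q ^ ∣ 𝒫*._ₘ (J ᶜ) ∣
  in
  -- |Stab(J^c)|/denJc · P = |Stab(I)|/denI · Q, denominators cleared
  ι (stabSize H (J ᶜ)) * ι denI * Pval ≈ ι (stabSize H I) * ι denJc * Qval
corollary4p2 F R χ chr n P H sg I J I-ideal J-ideal u v u∈S v∈S* =
  cross-multiply (length H) {{member⇒NonZero (IsSubgroupOfAut.has-id sg)}}
    (𝒫-counting.stabilizer-sphere I I-ideal)
    (𝒫*-counting.stabilizer-sphere (J ᶜ) (complement-ideal P J J-ideal))
    (double-count (S I) (S* (J ᶜ)) (λ u′ w → χ (u′ · w)) rows columns)
  where
  open FieldSums F R
  open Spheres P H
  module 𝒫-counting = SphereCounting F R P H sg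
  module 𝒫*-counting = SphereCounting F R (dual P) H (dual-subgroup sg)
  module 𝒫-sums = SphereSums F R χ chr P H sg
  module 𝒫*-sums = SphereSums F R χ chr (dual P) H (dual-subgroup sg)
  rows : ∀ u′ → u′ ∈ S I → Σ[ S* (J ᶜ) ] (λ w → χ (u′ · w)) ≈ Σ[ S* (J ᶜ) ] (λ w → χ (u · w))
  rows u′ u′∈ = 𝒫-sums.sphereSum-independent I (J ᶜ) u′ u (proj₂ (∈ₚ.∈-filter⁻ (λ y → E? H 𝒫.⟨ supp y ⟩ I) {xs = allVecs n} u′∈)) u∈S
  columns : ∀ w → w ∈ S* (J ᶜ) → Σ[ S I ] (λ u′ → χ (u′ · w)) ≈ Σ[ S I ] (λ u′ → χ (u′ · v))
  columns w w∈ = begin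
    Σ[ S I ] (λ u′ → χ (u′ · w))  ≈⟨ Σ-cong (S I) (λ u′ → reflexive (≡.cong χ (·-comm u′ w))) ⟩
    Σ[ S I ] (λ u′ → χ (w · u′))  ≈⟨ 𝒫*-sums.sphereSum-independent (J ᶜ) I w v (proj₂ (∈ₚ.∈-filter⁻ (λ y → E? H 𝒫*.⟨ supp y ⟩ (J ᶜ)) {xs = allVecs n} w∈)) v∈S* ⟩
    Σ[ S I ] (λ u′ → χ (v · u′))  ≈⟨ Σ-cong (S I) (λ u′ → reflexive (≡.cong χ (·-comm v u′))) ⟩
    Σ[ S I ] (λ u′ → χ (u′ · v))  ∎
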